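{- The following structure on the term category $\mathcal{T}$ of $\lambda_{\mathrm{eff}}$ is a $\lambda_{\mathrm{eff}}$-model. For each semantic signature $S$ (identified with a syntactic signature), $T_S$ is the strong monad given by the strong Kleisli triple with $T_S A = \mathtt{unit}\to A!S$, unit $x:A\vdash\lambda y.\mathtt{return}\ x:\mathtt{unit}\to A!S$, and strong Kleisli extension of $x:A_1\times A_2\vdash V:\mathtt{unit}\to B!S$ given by $x':A_1\times(\mathtt{unit}\to A_2!S)\vdash\lambda y.\,\mathtt{let}\ x_2\Leftarrow\pi_2\,x'\,\langle\rangle\ \mathtt{in}\ V[\langle\pi_1x',x_2\rangle/x]\,\langle\rangle$. Kleisli exponentials are $A\to B!S$. $\mathrm{handle}_{S,S',A}$ is $x:\mathcal{H}_S(A!S')\times(\mathtt{unit}\to(\mathtt{unit}\to A!S')!S)\vdash\lambda z.\,\mathtt{handle}\ \pi_2\,x\,\langle\rangle\ \mathtt{with}\ H\ \mathtt{to}\ r.\ r\,\langle\rangle$, where $H=\{\mathtt{op}(y,k)\mapsto\pi_{\mathtt{op}}(\pi_1x)\langle y,k\rangle\mid(\mathtt{op}:A_{\mathtt{op}}\to B_{\mathtt{op}})\in S\}$. Operations are interpreted as $x:A_{\mathtt{op}}\vdash\lambda y.\mathtt{op}(x):\mathtt{unit}\to B_{\mathtt{op}}!S$.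
   Context: $\lambda_{\mathrm{eff}}$: fine-grain CBV calculus with value types $A::=A\to C\mid\prod A_i$ ($\mathtt{unit}$ the empty product), computation types $A!\Sigma$, signatures finite sets of entries $\mathtt{op}:A\to B$ (operation with argument type $A$ and result type $B$; this arrow denotes an operation signature), values $x,\lambda x.M,\langle\dots\rangle,\pi_iV$, computations $V\,W$, $\mathtt{return}\ V$, $\mathtt{let}\ x\Leftarrow M\ \mathtt{in}\ N$, $\mathtt{op}(V)$, $\mathtt{handle}\ M\ \mathtt{with}\ H\ \mathtt{to}\ x.N$, and handlers finite sets of clauses $\mathtt{op}(x,k)\mapsto M_{\mathtt{op}}$; equational theory the least congruence containing $\beta\eta$ for functions and products, monad laws, and the three handler laws (handling $\mathtt{return}\ V$ gives $M[V/x]$; handling a $\mathtt{let}$ gives nested handles; handling $\mathtt{op}(V)$ gives $M_{\mathtt{op}}[V/x,\lambda x.M/k]$). The term category $\mathcal{T}$ has value types as objects and value terms $x:A\vdash V:B$ modulo provable equality as morphisms, identities $x$, composition by substitution; it is cartesian with products given by product types. $\mathcal{H}_S(X)$ denotes the product type $\prod_{(\mathtt{op}:A_{\mathtt{op}}\to B_{\mathtt{op}})\in S}(A_{\mathtt{op}}\times(B_{\mathtt{op}}\to X)\to X)$ for a computation type $X$. A $\lambda_{\mathrm{eff}}$-model: cartesian category with strong monads $T_S$ per semantic signature, Kleisli exponentials, morphisms $[\![\mathtt{op}]\!]_S:A_{\mathtt{op}}\to T_SB_{\mathtt{op}}$, and $\mathrm{handle}_{S,S',X}:\mathcal{H}_S(X)\times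 T_ST_{S'}X\to T_{S'}X$ satisfying $\mathrm{handle}\circ(\mathrm{id}\times\eta)=\pi_2$, $\mathrm{handle}\circ(\mathrm{id}\times\mu)=\mathrm{handle}\circ(\mathrm{id}\times T_S\mathrm{handle})\circ\langle\pi_1,\mathrm{st}\rangle$, $\mathrm{handle}\circ(\mathrm{id}\times a_{\mathtt{op}})=\mathrm{ev}\circ(\pi_{\mathtt{op}}\times\mathrm{id})$ with $a_{\mathtt{op}}=T_S\mathrm{ev}\circ\mathrm{st}\circ\mathrm{swap}\circ([\![\mathtt{op}]\!]_S\times\mathrm{id})$. -}

module Defs where

open import Data.List using (List; []; _∷_)
open import Data.Product using (Σ; _×_; _,_)

data Idx {X : Set} : List X → X → Set where
  here  : ∀ {x xs} → Idx (x ∷ xs) x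
  there : ∀ {x y xs} → Idx xs x → Idx (y ∷ xs) x

-- Types of λ_eff.  A signature is a finite list of entries op : A → B;
-- an operation of S is identified with its position in S.

mutual
  data VTy : Set where
    _⇒_ : VTy → CTy → VTy
    Π   : List VTy → VTy

  data CTy : Set where
    _!_ : VTy → List (VTy × VTy) → CTy

infixr 7 _⇒_
infix 8 _!_

Sig : Set
Sig = List (VTy × VTy)

Ctx : Set
Ctx = List VTy

mutual
  data Val (Γ : Ctx) : VTy → Set where
    var  : ∀ {A} → Idx Γ A → Val Γ A
    lam  : ∀ {A C} → Comp (A ∷ Γ) C → Val Γ (A ⇒ C)
    tup  : ∀ {As} → Vals Γ As → Val Γ (Π As)
    proj : ∀ {As A} → Idx As A → Val Γ (Π As) → Val Γ A

  data Vals (Γ : Ctx) : List VTy → Set where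
    []  : Vals Γ []
    _∷_ : ∀ {A As} → Val Γ A → Vals Γ As → Vals Γ (A ∷ As)

  data Comp (Γ : Ctx) : CTy → Set where
    app    : ∀ {A C} → Val Γ (A ⇒ C) → Val Γ A → Comp Γ C
    ret    : ∀ {A S} → Val Γ A → Comp Γ (A ! S)
    letin  : ∀ {A B S} → Comp Γ (A ! S) → Comp (A ∷ Γ) (B ! S) → Comp Γ (B ! S)
    op     : ∀ {S A B} → Idx S (A , B) → Val Γ A → Comp Γ (B ! S)
    handle : ∀ {A S X} → Comp Γ (A ! S) → Hdl Γ S X → Comp (A ∷ Γ) X → Comp Γ X

  -- a handler for S into X: one clause op(x,k) ↦ M_op per entry of S,
  -- with x the (second) and k the (first, innermost) bound variable
  data Hdl (Γ : Ctx) : Sig → CTy → Set where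
    []  : ∀ {X} → Hdl Γ [] X
    _∷_ : ∀ {A B S X} → Comp ((B ⇒ X) ∷ A ∷ Γ) X → Hdl Γ S X → Hdl Γ ((A , B) ∷ S) X

Ren : Ctx → Ctx → Set
Ren Γ Δ = ∀ {A} → Idx Γ A → Idx Δ A

wkR : ∀ {Γ B} → Ren Γ (B ∷ Γ)
wkR i = there i

liftR : ∀ {Γ Δ B} → Ren Γ Δ → Ren (B ∷ Γ) (B ∷ Δ)
liftR ρ here      = here
liftR ρ (there i) = there (ρ i)

mutual
  renV : ∀ {Γ Δ A} → Ren Γ Δ → Val Γ A → Val Δ A
  renV ρ (var i)    = var (ρ i)
  renV ρ (lam M)    = lam (renC (liftR ρ) M)
  renV ρ (tup Vs)   = tup (renVs ρ Vs)
  renV ρ (proj i V) = proj i (renV ρ V)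

  renVs : ∀ {Γ Δ As} → Ren Γ Δ → Vals Γ As → Vals Δ As
  renVs ρ []       = []
  renVs ρ (V ∷ Vs) = renV ρ V ∷ renVs ρ Vs

  renC : ∀ {Γ Δ C} → Ren Γ Δ → Comp Γ C → Comp Δ C
  renC ρ (app V W)      = app (renV ρ V) (renV ρ W)
  renC ρ (ret V)        = ret (renV ρ V)
  renC ρ (letin M N)    = letin (renC ρ M) (renC (liftR ρ) N)
  renC ρ (op i V)       = op i (renV ρ V)
  renC ρ (handle M H N) = handle (renC ρ M) (renH ρ H) (renC (liftR ρ) N)

  renH : ∀ {Γ Δ S X} → Ren Γ Δ → Hdl Γ S X → Hdl Δ S X
  renH ρ []      = []
  renH ρ (M ∷ H) = renC (liftR (liftR ρ)) M ∷ renH ρ H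

Sub : Ctx → Ctx → Set
Sub Γ Δ = ∀ {A} → Idx Γ A → Val Δ A

liftS : ∀ {Γ Δ B} → Sub Γ Δ → Sub (B ∷ Γ) (B ∷ Δ)
liftS σ here      = var here
liftS σ (there i) = renV wkR (σ i)

mutual
  subV : ∀ {Γ Δ A} → Sub Γ Δ → Val Γ A → Val Δ A
  subV σ (var i)    = σ i
  subV σ (lam M)    = lam (subC (liftS σ) M)
  subV σ (tup Vs)   = tup (subVs σ Vs)
  subV σ (proj i V) = proj i (subV σ V)

  subVs : ∀ {Γ Δ As} → Sub Γ Δ → Vals Γ As → Vals Δ As
  subVs σ []       = []
  subVs σ (V ∷ Vs) = subV σ V ∷ subVs σ Vs

  subC : ∀ {Γ Δ C} → Sub Γ Δ → Comp Γ C → Comp Δ C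
  subC σ (app V W)      = app (subV σ V) (subV σ W)
  subC σ (ret V)        = ret (subV σ V)
  subC σ (letin M N)    = letin (subC σ M) (subC (liftS σ) N)
  subC σ (op i V)       = op i (subV σ V)
  subC σ (handle M H N) = handle (subC σ M) (subH σ H) (subC (liftS σ) N)

  subH : ∀ {Γ Δ S X} → Sub Γ Δ → Hdl Γ S X → Hdl Δ S X
  subH σ []      = []
  subH σ (M ∷ H) = subC (liftS (liftS σ)) M ∷ subH σ H

sub1 : ∀ {Γ A} → Val Γ A → Sub (A ∷ Γ) Γ
sub1 V here      = V
sub1 V (there i) = var i

_[_]c : ∀ {Γ A C} → Comp (A ∷ Γ) C → Val Γ A → Comp Γ C
N [ V ]c = subC (sub1 V) N

sub2 : ∀ {Γ A K} → Val Γ A → Val Γ K → Sub (K ∷ A ∷ Γ) Γ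
sub2 V W here              = W
sub2 V W (there here)      = V
sub2 V W (there (there i)) = var i

lookupVs : ∀ {Γ As A} → Vals Γ As → Idx As A → Val Γ A
lookupVs (V ∷ Vs) here      = V
lookupVs (V ∷ Vs) (there i) = lookupVs Vs i

tabulateVs : ∀ {Γ As} → (∀ {A} → Idx As A → Val Γ A) → Vals Γ As
tabulateVs {As = []}     f = []
tabulateVs {As = A ∷ As} f = f here ∷ tabulateVs (λ i → f (there i))

lookupH : ∀ {Γ S X A B} → Hdl Γ S X → Idx S (A , B) → Comp ((B ⇒ X) ∷ A ∷ Γ) X
lookupH (M ∷ H) here      = M
lookupH (M ∷ H) (there i) = lookupH H i

infix 4 _≈v_ _≈vs_ _≈c_ _≈h_

mutual
  data _≈v_ {Γ : Ctx} : ∀ {A} → Val Γ A → Val Γ A → Set where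
    reflv  : ∀ {A} {V : Val Γ A} → V ≈v V
    symv   : ∀ {A} {V W : Val Γ A} → V ≈v W → W ≈v V
    transv : ∀ {A} {U V W : Val Γ A} → U ≈v V → V ≈v W → U ≈v W
    lamc   : ∀ {A C} {M N : Comp (A ∷ Γ) C} → M ≈c N → lam M ≈v lam N
    tupc   : ∀ {As} {Vs Ws : Vals Γ As} → Vs ≈vs Ws → tup Vs ≈v tup Ws
    projc  : ∀ {As A} (i : Idx As A) {V W : Val Γ (Π As)} → V ≈v W → proj i V ≈v proj i W
    Πβ     : ∀ {As A} (Vs : Vals Γ As) (i : Idx As A) → proj i (tup Vs) ≈v lookupVs Vs i
    Πη     : ∀ {As} (V : Val Γ (Π As)) → V ≈v tup (tabulateVs (λ i → proj i V))
    ⇒η     : ∀ {A C} (V : Val Γ (A ⇒ C)) → V ≈v lam (app (renV wkR V) (var here))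

  data _≈vs_ {Γ : Ctx} : ∀ {As} → Vals Γ As → Vals Γ As → Set where
    []  : [] ≈vs []
    _∷_ : ∀ {A As} {V W : Val Γ A} {Vs Ws : Vals Γ As} → V ≈v W → Vs ≈vs Ws → (V ∷ Vs) ≈vs (W ∷ Ws)

  data _≈c_ {Γ : Ctx} : ∀ {C} → Comp Γ C → Comp Γ C → Set where
    reflc    : ∀ {C} {M : Comp Γ C} → M ≈c M
    symc     : ∀ {C} {M N : Comp Γ C} → M ≈c N → N ≈c M
    transc   : ∀ {C} {M N P : Comp Γ C} → M ≈c N → N ≈c P → M ≈c P
    appc     : ∀ {A C} {V V' : Val Γ (A ⇒ C)} {W W' : Val Γ A} → V ≈v V' → W ≈v W' → app V W ≈c app V' W'
    retc     : ∀ {A S} {V W : Val Γ A} → V ≈v W → ret {S = S} V ≈c ret W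
    letc     : ∀ {A B S} {M M' : Comp Γ (A ! S)} {N N' : Comp (A ∷ Γ) (B ! S)} → M ≈c M' → N ≈c N' → letin M N ≈c letin M' N'
    opc      : ∀ {S A B} (i : Idx S (A , B)) {V W : Val Γ A} → V ≈v W → op i V ≈c op i W
    handlec  : ∀ {A S X} {M M' : Comp Γ (A ! S)} {H H' : Hdl Γ S X} {N N' : Comp (A ∷ Γ) X} → M ≈c M' → H ≈h H' → N ≈c N' → handle M H N ≈c handle M' H' N'
    ⇒β       : ∀ {A C} (M : Comp (A ∷ Γ) C) (V : Val Γ A) → app (lam M) V ≈c M [ V ]c
    letβ     : ∀ {A B S} (V : Val Γ A) (N : Comp (A ∷ Γ) (B ! S)) → letin (ret V) N ≈c N [ V ]c
    letη     : ∀ {A S} (M : Comp Γ (A ! S)) → letin M (ret (var here)) ≈c M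
    letassoc : ∀ {A B D S} (M : Comp Γ (A ! S)) (N : Comp (A ∷ Γ) (B ! S)) (P : Comp (B ∷ Γ) (D ! S))
               → letin (letin M N) P ≈c letin M (letin N (renC (liftR wkR) P))
    hret     : ∀ {A S X} (V : Val Γ A) (H : Hdl Γ S X) (N : Comp (A ∷ Γ) X) → handle (ret V) H N ≈c N [ V ]c
    hlet     : ∀ {A B S X} (M : Comp Γ (A ! S)) (N' : Comp (A ∷ Γ) (B ! S)) (H : Hdl Γ S X) (N : Comp (B ∷ Γ) X)
               → handle (letin M N') H N ≈c handle M H (handle N' (renH wkR H) (renC (liftR wkR) N))
    hop      : ∀ {S A B X} (i : Idx S (A , B)) (V : Val Γ A) (H : Hdl Γ S X) (N : Comp (B ∷ Γ) X)
               → handle (op i V) H N ≈c subC (sub2 V (lam N)) (lookupH H i)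

  data _≈h_ {Γ : Ctx} : ∀ {S X} → Hdl Γ S X → Hdl Γ S X → Set where
    []  : ∀ {X} → [] {X = X} ≈h []
    _∷_ : ∀ {A B S X} {M N : Comp ((B ⇒ X) ∷ A ∷ Γ) X} {H H' : Hdl Γ S X} → M ≈c N → H ≈h H' → (M ∷ H) ≈h (N ∷ H')

-- The term category 𝒯: objects value types, morphisms x : A ⊢ V : B
-- modulo provable equality (a setoid of hom-sets).

Hom : VTy → VTy → Set
Hom A B = Val (A ∷ []) B

infix 4 _≈_
_≈_ : ∀ {A B} → Hom A B → Hom A B → Set
f ≈ g = f ≈v g

idᴴ : ∀ {A} → Hom A A
idᴴ = var here

⟪_⟫ : ∀ {Δ A} → Val Δ A → Sub (A ∷ []) Δ
⟪ V ⟫ here = V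
⟪ V ⟫ (there ())

infixr 9 _∘_
_∘_ : ∀ {A B C} → Hom B C → Hom A B → Hom A C
g ∘ f = subV ⟪ f ⟫ g

𝟙 : VTy
𝟙 = Π []

infixr 6 _⊗_
_⊗_ : VTy → VTy → VTy
A ⊗ B = Π (A ∷ B ∷ [])

projᴴ : ∀ {As A} → Idx As A → Hom (Π As) A
projᴴ i = proj i (var here)

tupleᴴ : ∀ {C As} → (∀ {A} → Idx As A → Hom C A) → Hom C (Π As)
tupleᴴ fs = tup (tabulateVs fs)

π₁ᴴ : ∀ {A B} → Hom (A ⊗ B) A
π₁ᴴ = proj here (var here)

π₂ᴴ : ∀ {A B} → Hom (A ⊗ B) B
π₂ᴴ = proj (there here) (var here)

⟨_,_⟩ᴴ : ∀ {C A B} → Hom C A → Hom C B → Hom C (A ⊗ B)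
⟨ f , g ⟩ᴴ = tup (f ∷ g ∷ [])

!ᴴ : ∀ {C} → Hom C 𝟙
!ᴴ = tup []

infixr 7 _×ᴴ_
_×ᴴ_ : ∀ {A A' B B'} → Hom A A' → Hom B B' → Hom (A ⊗ B) (A' ⊗ B')
f ×ᴴ g = ⟨ f ∘ π₁ᴴ , g ∘ π₂ᴴ ⟩ᴴ

swapᴴ : ∀ {A B} → Hom (A ⊗ B) (B ⊗ A)
swapᴴ = ⟨ π₂ᴴ , π₁ᴴ ⟩ᴴ

T : Sig → VTy → VTy
T S A = 𝟙 ⇒ (A ! S)

ηᴴ : ∀ S {A} → Hom A (T S A)
ηᴴ S = lam (ret (var (there here)))

-- strong Kleisli extension of x : A₁ × A₂ ⊢ V : unit → B!S :
-- x' : A₁ × (unit → A₂!S) ⊢ λy. let x₂ ⇐ π₂ x' ⟨⟩ in V[⟨π₁ x', x₂⟩/x] ⟨⟩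
extᴴ : ∀ {S A₁ A₂ B} → Hom (A₁ ⊗ A₂) (T S B) → Hom (A₁ ⊗ T S A₂) (T S B)
extᴴ V =
  lam (letin (app (proj (there here) (var (there here))) (tup []))
             (app (subV ⟪ tup (proj here (var (there (there here))) ∷ var here ∷ []) ⟫ V) (tup [])))

stᴴ : ∀ S {C A} → Hom (C ⊗ T S A) (T S (C ⊗ A))
stᴴ S = extᴴ (ηᴴ S)

Tᴴ : ∀ S {A B} → Hom A B → Hom (T S A) (T S B)
Tᴴ S f = extᴴ (ηᴴ S ∘ (f ∘ π₂ᴴ {𝟙})) ∘ ⟨ !ᴴ , idᴴ ⟩ᴴ

μᴴ : ∀ S {A} → Hom (T S (T S A)) (T S A)
μᴴ S = extᴴ (π₂ᴴ {𝟙}) ∘ ⟨ !ᴴ , idᴴ ⟩ᴴ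

evᴴ : ∀ {S A B} → Hom ((A ⇒ (B ! S)) ⊗ A) (T S B)
evᴴ = lam (app (proj here (var (there here))) (proj (there here) (var (there here))))

opᴴ : ∀ {S A B} → Idx S (A , B) → Hom A (T S B)
opᴴ i = lam (op i (var (there here)))

hsig : Sig → CTy → List VTy
hsig []            X = []
hsig ((A , B) ∷ S) X = ((A ⊗ (B ⇒ X)) ⇒ X) ∷ hsig S X

HT : Sig → CTy → VTy
HT S X = Π (hsig S X)

hidx : ∀ {S X A B} → Idx S (A , B) → Idx (hsig S X) ((A ⊗ (B ⇒ X)) ⇒ X)
hidx here      = here
hidx (there i) = there (hidx i)

buildH : ∀ {Γ S X} → (∀ {A B} → Idx S (A , B) → Comp ((B ⇒ X) ∷ A ∷ Γ) X) → Hdl Γ S X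
buildH {S = []}          f = []
buildH {S = (A , B) ∷ S} f = f here ∷ buildH (λ i → f (there i))

-- handle_{S,S',A}:
-- x : H_S(A!S') × (unit → (unit → A!S')!S) ⊢
--   λz. handle π₂ x ⟨⟩ with {op(y,k) ↦ π_op (π₁ x) ⟨y,k⟩} to r. r ⟨⟩
handleᴴ : ∀ S S' A → Hom (HT S (A ! S') ⊗ T S (T S' A)) (T S' A)
handleᴴ S S' A =
  lam (handle (app (proj (there here) (var (there here))) (tup []))
              (buildH (λ i → app (proj (hidx i) (proj here (var (there (there (there here))))))
                                 (tup (var (there here) ∷ var here ∷ []))))
              (app (var here) (tup [])))

aᴴ : ∀ {S} S' {X A B} → Idx S (A , B) → Hom (A ⊗ (B ⇒ (X ! S'))) (T S (T S' X))
aᴴ {S} S' i = Tᴴ S evᴴ ∘ (stᴴ S ∘ (swapᴴ ∘ (opᴴ i ×ᴴ idᴴ)))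

record TermModelAxioms : Set where
  field
    ∘-resp  : ∀ {A B C} {f f' : Hom A B} {g g' : Hom B C} → f ≈ f' → g ≈ g' → g ∘ f ≈ g' ∘ f'
    idˡ     : ∀ {A B} (f : Hom A B) → idᴴ ∘ f ≈ f
    idʳ     : ∀ {A B} (f : Hom A B) → f ∘ idᴴ ≈ f
    assoc   : ∀ {A B C D} (f : Hom A B) (g : Hom B C) (h : Hom C D) → (h ∘ g) ∘ f ≈ h ∘ (g ∘ f)
    tuple-resp : ∀ {C As} {fs gs : ∀ {A} → Idx As A → Hom C A}
                 → (∀ {A} (i : Idx As A) → fs i ≈ gs i) → tupleᴴ fs ≈ tupleᴴ gs
    tuple-β : ∀ {C As A} (fs : ∀ {B} → Idx As B → Hom C B) (i : Idx As A) → projᴴ i ∘ tupleᴴ fs ≈ fs i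
    tuple-η : ∀ {C As} (h : Hom C (Π As)) → h ≈ tupleᴴ (λ i → projᴴ i ∘ h)
    ext-resp : ∀ {S C A B} {f g : Hom (C ⊗ A) (T S B)} → f ≈ g → extᴴ f ≈ extᴴ g
    kl-unitˡ : ∀ {S C A B} (f : Hom (C ⊗ A) (T S B)) → extᴴ f ∘ (idᴴ ×ᴴ ηᴴ S) ≈ f
    kl-unitʳ : ∀ {S C A} → extᴴ (ηᴴ S ∘ π₂ᴴ {C} {A}) ≈ π₂ᴴ
    kl-assoc : ∀ {S C A B D} (f : Hom (C ⊗ A) (T S B)) (g : Hom (C ⊗ B) (T S D))
               → extᴴ g ∘ ⟨ π₁ᴴ , extᴴ f ⟩ᴴ ≈ extᴴ (extᴴ g ∘ ⟨ π₁ᴴ , f ⟩ᴴ)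
    kl-nat   : ∀ {S C C' A B} (h : Hom C' C) (f : Hom (C ⊗ A) (T S B))
               → extᴴ f ∘ (h ×ᴴ idᴴ) ≈ extᴴ (f ∘ (h ×ᴴ idᴴ))
    kl-exp : ∀ {S A B C} (f : Hom (C ⊗ A) (T S B))
             → Σ (Hom C (A ⇒ (B ! S))) λ g
                 → (evᴴ ∘ (g ×ᴴ idᴴ) ≈ f) × (∀ g' → evᴴ ∘ (g' ×ᴴ idᴴ) ≈ f → g' ≈ g)
    handle-η  : ∀ {S S' X} → handleᴴ S S' X ∘ (idᴴ ×ᴴ ηᴴ S) ≈ π₂ᴴ
    handle-μ  : ∀ {S S' X}
                → handleᴴ S S' X ∘ (idᴴ ×ᴴ μᴴ S)
                  ≈ handleᴴ S S' X ∘ ((idᴴ ×ᴴ Tᴴ S (handleᴴ S S' X)) ∘ ⟨ π₁ᴴ , stᴴ S ⟩ᴴ)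
    handle-op : ∀ {S S' X A B} (i : Idx S (A , B))
                → handleᴴ S S' X ∘ (idᴴ ×ᴴ aᴴ S' i) ≈ evᴴ ∘ (projᴴ (hidx i) ×ᴴ idᴴ)

{-# OPTIONS --safe #-}
-- Every structure map of the model is, up to provable equality, a thunk λ_. M of an
-- open computation, and a morphism f acts on an open value v by substitution (f · v).
-- Applying both sides of an axiom to a pair ⟨c, m⟩ of open values thus turns it into an
-- equation between computations: extᴴ f becomes the strong bind of f, so the Kleisli laws
-- reduce to the monad laws of let, and handleᴴ becomes handling with the handler whose
-- clauses call the components of c, so the model's handler laws reduce to those of λ_eff.
-- Besides β and η for thunks and pairs, all this needs is the substitution lemma:
-- substitutions compose and respect provable equality in both arguments.

module Submission where

open import Data.List using ([]; _∷_)
open import Data.Product using (_,_)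
open import Relation.Binary.Bundles using (Setoid)
import Relation.Binary.Reasoning.Setoid as SetoidReasoning
open import Relation.Binary.PropositionalEquality using (_≡_; refl; sym; trans; cong; cong₂)
open import Defs

cong₃ : ∀ {A B C D : Set} (f : A → B → C → D) {a a' b b' c c'}
  → a ≡ a' → b ≡ b' → c ≡ c' → f a b c ≡ f a' b' c'
cong₃ f refl refl refl = refl

wk : ∀ {Γ A B} → Val Γ A → Val (B ∷ Γ) A
wk = renV wkR

liftR-liftR : ∀ {Γ Δ Θ B} {ρ' : Ren Δ Θ} {ρ : Ren Γ Δ} {ρ'' : Ren Γ Θ}
  → (∀ {A} (i : Idx Γ A) → ρ' (ρ i) ≡ ρ'' i)
  → ∀ {A} (i : Idx (B ∷ Γ) A) → liftR ρ' (liftR ρ i) ≡ liftR ρ'' i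
liftR-liftR h here      = refl
liftR-liftR h (there i) = cong there (h i)

mutual
  renV-renV : ∀ {Γ Δ Θ A} {ρ' : Ren Δ Θ} {ρ : Ren Γ Δ} {ρ'' : Ren Γ Θ}
    → (∀ {B} (i : Idx Γ B) → ρ' (ρ i) ≡ ρ'' i) → (V : Val Γ A) → renV ρ' (renV ρ V) ≡ renV ρ'' V
  renV-renV h (var i)    = cong var (h i)
  renV-renV h (lam M)    = cong lam (renC-renC (liftR-liftR h) M)
  renV-renV h (tup Vs)   = cong tup (renVs-renVs h Vs)
  renV-renV h (proj i V) = cong (proj i) (renV-renV h V)

  renVs-renVs : ∀ {Γ Δ Θ As} {ρ' : Ren Δ Θ} {ρ : Ren Γ Δ} {ρ'' : Ren Γ Θ}
    → (∀ {B} (i : Idx Γ B) → ρ' (ρ i) ≡ ρ'' i) → (Vs : Vals Γ As) → renVs ρ' (renVs ρ Vs) ≡ renVs ρ'' Vs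
  renVs-renVs h []       = refl
  renVs-renVs h (V ∷ Vs) = cong₂ _∷_ (renV-renV h V) (renVs-renVs h Vs)

  renC-renC : ∀ {Γ Δ Θ C} {ρ' : Ren Δ Θ} {ρ : Ren Γ Δ} {ρ'' : Ren Γ Θ}
    → (∀ {B} (i : Idx Γ B) → ρ' (ρ i) ≡ ρ'' i) → (M : Comp Γ C) → renC ρ' (renC ρ M) ≡ renC ρ'' M
  renC-renC h (app V W)      = cong₂ app (renV-renV h V) (renV-renV h W)
  renC-renC h (ret V)        = cong ret (renV-renV h V)
  renC-renC h (letin M N)    = cong₂ letin (renC-renC h M) (renC-renC (liftR-liftR h) N)
  renC-renC h (op i V)       = cong (op i) (renV-renV h V)
  renC-renC h (handle M H N) = cong₃ handle (renC-renC h M) (renH-renH h H) (renC-renC (liftR-liftR h) N)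

  renH-renH : ∀ {Γ Δ Θ S X} {ρ' : Ren Δ Θ} {ρ : Ren Γ Δ} {ρ'' : Ren Γ Θ}
    → (∀ {B} (i : Idx Γ B) → ρ' (ρ i) ≡ ρ'' i) → (H : Hdl Γ S X) → renH ρ' (renH ρ H) ≡ renH ρ'' H
  renH-renH h []      = refl
  renH-renH h (M ∷ H) = cong₂ _∷_ (renC-renC (liftR-liftR (liftR-liftR h)) M) (renH-renH h H)

renV-liftR-wk : ∀ {Γ Δ A B} (ρ : Ren Γ Δ) (V : Val Γ A) → renV (liftR {B = B} ρ) (wk V) ≡ wk (renV ρ V)
renV-liftR-wk ρ V = trans (renV-renV (λ _ → refl) V) (sym (renV-renV (λ _ → refl) V))

liftS-liftR : ∀ {Γ Δ Θ B} {σ : Sub Δ Θ} {ρ : Ren Γ Δ} {σ'' : Sub Γ Θ}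
  → (∀ {A} (i : Idx Γ A) → σ (ρ i) ≡ σ'' i)
  → ∀ {A} (i : Idx (B ∷ Γ) A) → liftS σ (liftR ρ i) ≡ liftS σ'' i
liftS-liftR h here      = refl
liftS-liftR h (there i) = cong wk (h i)

mutual
  subV-renV : ∀ {Γ Δ Θ A} {σ : Sub Δ Θ} {ρ : Ren Γ Δ} {σ'' : Sub Γ Θ}
    → (∀ {B} (i : Idx Γ B) → σ (ρ i) ≡ σ'' i) → (V : Val Γ A) → subV σ (renV ρ V) ≡ subV σ'' V
  subV-renV h (var i)    = h i
  subV-renV h (lam M)    = cong lam (subC-renC (liftS-liftR h) M)
  subV-renV h (tup Vs)   = cong tup (subVs-renVs h Vs)
  subV-renV h (proj i V) = cong (proj i) (subV-renV h V)

  subVs-renVs : ∀ {Γ Δ Θ As} {σ : Sub Δ Θ} {ρ : Ren Γ Δ} {σ'' : Sub Γ Θ}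
    → (∀ {B} (i : Idx Γ B) → σ (ρ i) ≡ σ'' i) → (Vs : Vals Γ As) → subVs σ (renVs ρ Vs) ≡ subVs σ'' Vs
  subVs-renVs h []       = refl
  subVs-renVs h (V ∷ Vs) = cong₂ _∷_ (subV-renV h V) (subVs-renVs h Vs)

  subC-renC : ∀ {Γ Δ Θ C} {σ : Sub Δ Θ} {ρ : Ren Γ Δ} {σ'' : Sub Γ Θ}
    → (∀ {B} (i : Idx Γ B) → σ (ρ i) ≡ σ'' i) → (M : Comp Γ C) → subC σ (renC ρ M) ≡ subC σ'' M
  subC-renC h (app V W)      = cong₂ app (subV-renV h V) (subV-renV h W)
  subC-renC h (ret V)        = cong ret (subV-renV h V)
  subC-renC h (letin M N)    = cong₂ letin (subC-renC h M) (subC-renC (liftS-liftR h) N)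
  subC-renC h (op i V)       = cong (op i) (subV-renV h V)
  subC-renC h (handle M H N) = cong₃ handle (subC-renC h M) (subH-renH h H) (subC-renC (liftS-liftR h) N)

  subH-renH : ∀ {Γ Δ Θ S X} {σ : Sub Δ Θ} {ρ : Ren Γ Δ} {σ'' : Sub Γ Θ}
    → (∀ {B} (i : Idx Γ B) → σ (ρ i) ≡ σ'' i) → (H : Hdl Γ S X) → subH σ (renH ρ H) ≡ subH σ'' H
  subH-renH h []      = refl
  subH-renH h (M ∷ H) = cong₂ _∷_ (subC-renC (liftS-liftR (liftS-liftR h)) M) (subH-renH h H)

liftR-liftS : ∀ {Γ Δ Θ B} {ρ : Ren Δ Θ} {σ : Sub Γ Δ} {σ'' : Sub Γ Θ}
  → (∀ {A} (i : Idx Γ A) → renV ρ (σ i) ≡ σ'' i)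
  → ∀ {A} (i : Idx (B ∷ Γ) A) → renV (liftR ρ) (liftS σ i) ≡ liftS σ'' i
liftR-liftS h here              = refl
liftR-liftS {ρ = ρ} {σ} h (there i) = trans (renV-liftR-wk ρ (σ i)) (cong wk (h i))

mutual
  renV-subV : ∀ {Γ Δ Θ A} {ρ : Ren Δ Θ} {σ : Sub Γ Δ} {σ'' : Sub Γ Θ}
    → (∀ {B} (i : Idx Γ B) → renV ρ (σ i) ≡ σ'' i) → (V : Val Γ A) → renV ρ (subV σ V) ≡ subV σ'' V
  renV-subV h (var i)    = h i
  renV-subV h (lam M)    = cong lam (renC-subC (liftR-liftS h) M)
  renV-subV h (tup Vs)   = cong tup (renVs-subVs h Vs)
  renV-subV h (proj i V) = cong (proj i) (renV-subV h V)

  renVs-subVs : ∀ {Γ Δ Θ As} {ρ : Ren Δ Θ} {σ : Sub Γ Δ} {σ'' : Sub Γ Θ}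
    → (∀ {B} (i : Idx Γ B) → renV ρ (σ i) ≡ σ'' i) → (Vs : Vals Γ As) → renVs ρ (subVs σ Vs) ≡ subVs σ'' Vs
  renVs-subVs h []       = refl
  renVs-subVs h (V ∷ Vs) = cong₂ _∷_ (renV-subV h V) (renVs-subVs h Vs)

  renC-subC : ∀ {Γ Δ Θ C} {ρ : Ren Δ Θ} {σ : Sub Γ Δ} {σ'' : Sub Γ Θ}
    → (∀ {B} (i : Idx Γ B) → renV ρ (σ i) ≡ σ'' i) → (M : Comp Γ C) → renC ρ (subC σ M) ≡ subC σ'' M
  renC-subC h (app V W)      = cong₂ app (renV-subV h V) (renV-subV h W)
  renC-subC h (ret V)        = cong ret (renV-subV h V)
  renC-subC h (letin M N)    = cong₂ letin (renC-subC h M) (renC-subC (liftR-liftS h) N)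
  renC-subC h (op i V)       = cong (op i) (renV-subV h V)
  renC-subC h (handle M H N) = cong₃ handle (renC-subC h M) (renH-subH h H) (renC-subC (liftR-liftS h) N)

  renH-subH : ∀ {Γ Δ Θ S X} {ρ : Ren Δ Θ} {σ : Sub Γ Δ} {σ'' : Sub Γ Θ}
    → (∀ {B} (i : Idx Γ B) → renV ρ (σ i) ≡ σ'' i) → (H : Hdl Γ S X) → renH ρ (subH σ H) ≡ subH σ'' H
  renH-subH h []      = refl
  renH-subH h (M ∷ H) = cong₂ _∷_ (renC-subC (liftR-liftS (liftR-liftS h)) M) (renH-subH h H)

subV-liftS-wk : ∀ {Γ Δ A B} (σ : Sub Γ Δ) (V : Val Γ A) → subV (liftS {B = B} σ) (wk V) ≡ wk (subV σ V)
subV-liftS-wk σ V = trans (subV-renV (λ _ → refl) V) (sym (renV-subV (λ _ → refl) V))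

liftS-liftS : ∀ {Γ Δ Θ B} {τ : Sub Δ Θ} {σ : Sub Γ Δ} {σ'' : Sub Γ Θ}
  → (∀ {A} (i : Idx Γ A) → subV τ (σ i) ≡ σ'' i)
  → ∀ {A} (i : Idx (B ∷ Γ) A) → subV (liftS τ) (liftS σ i) ≡ liftS σ'' i
liftS-liftS h here                  = refl
liftS-liftS {τ = τ} {σ} h (there i) = trans (subV-liftS-wk τ (σ i)) (cong wk (h i))

mutual
  subV-subV : ∀ {Γ Δ Θ A} {τ : Sub Δ Θ} {σ : Sub Γ Δ} {σ'' : Sub Γ Θ}
    → (∀ {B} (i : Idx Γ B) → subV τ (σ i) ≡ σ'' i) → (V : Val Γ A) → subV τ (subV σ V) ≡ subV σ'' V
  subV-subV h (var i)    = h i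
  subV-subV h (lam M)    = cong lam (subC-subC (liftS-liftS h) M)
  subV-subV h (tup Vs)   = cong tup (subVs-subVs h Vs)
  subV-subV h (proj i V) = cong (proj i) (subV-subV h V)

  subVs-subVs : ∀ {Γ Δ Θ As} {τ : Sub Δ Θ} {σ : Sub Γ Δ} {σ'' : Sub Γ Θ}
    → (∀ {B} (i : Idx Γ B) → subV τ (σ i) ≡ σ'' i) → (Vs : Vals Γ As) → subVs τ (subVs σ Vs) ≡ subVs σ'' Vs
  subVs-subVs h []       = refl
  subVs-subVs h (V ∷ Vs) = cong₂ _∷_ (subV-subV h V) (subVs-subVs h Vs)

  subC-subC : ∀ {Γ Δ Θ C} {τ : Sub Δ Θ} {σ : Sub Γ Δ} {σ'' : Sub Γ Θ}
    → (∀ {B} (i : Idx Γ B) → subV τ (σ i) ≡ σ'' i) → (M : Comp Γ C) → subC τ (subC σ M) ≡ subC σ'' M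
  subC-subC h (app V W)      = cong₂ app (subV-subV h V) (subV-subV h W)
  subC-subC h (ret V)        = cong ret (subV-subV h V)
  subC-subC h (letin M N)    = cong₂ letin (subC-subC h M) (subC-subC (liftS-liftS h) N)
  subC-subC h (op i V)       = cong (op i) (subV-subV h V)
  subC-subC h (handle M H N) = cong₃ handle (subC-subC h M) (subH-subH h H) (subC-subC (liftS-liftS h) N)

  subH-subH : ∀ {Γ Δ Θ S X} {τ : Sub Δ Θ} {σ : Sub Γ Δ} {σ'' : Sub Γ Θ}
    → (∀ {B} (i : Idx Γ B) → subV τ (σ i) ≡ σ'' i) → (H : Hdl Γ S X) → subH τ (subH σ H) ≡ subH σ'' H
  subH-subH h []      = refl
  subH-subH h (M ∷ H) = cong₂ _∷_ (subC-subC (liftS-liftS (liftS-liftS h)) M) (subH-subH h H)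

liftS-var : ∀ {Γ B} {σ : Sub Γ Γ} → (∀ {A} (i : Idx Γ A) → σ i ≡ var i)
  → ∀ {A} (i : Idx (B ∷ Γ) A) → liftS σ i ≡ var i
liftS-var h here      = refl
liftS-var h (there i) = cong wk (h i)

mutual
  subV-var : ∀ {Γ A} {σ : Sub Γ Γ} → (∀ {B} (i : Idx Γ B) → σ i ≡ var i) → (V : Val Γ A) → subV σ V ≡ V
  subV-var h (var i)    = h i
  subV-var h (lam M)    = cong lam (subC-var (liftS-var h) M)
  subV-var h (tup Vs)   = cong tup (subVs-var h Vs)
  subV-var h (proj i V) = cong (proj i) (subV-var h V)

  subVs-var : ∀ {Γ As} {σ : Sub Γ Γ} → (∀ {B} (i : Idx Γ B) → σ i ≡ var i) → (Vs : Vals Γ As) → subVs σ Vs ≡ Vs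
  subVs-var h []       = refl
  subVs-var h (V ∷ Vs) = cong₂ _∷_ (subV-var h V) (subVs-var h Vs)

  subC-var : ∀ {Γ C} {σ : Sub Γ Γ} → (∀ {B} (i : Idx Γ B) → σ i ≡ var i) → (M : Comp Γ C) → subC σ M ≡ M
  subC-var h (app V W)      = cong₂ app (subV-var h V) (subV-var h W)
  subC-var h (ret V)        = cong ret (subV-var h V)
  subC-var h (letin M N)    = cong₂ letin (subC-var h M) (subC-var (liftS-var h) N)
  subC-var h (op i V)       = cong (op i) (subV-var h V)
  subC-var h (handle M H N) = cong₃ handle (subC-var h M) (subH-var h H) (subC-var (liftS-var h) N)

  subH-var : ∀ {Γ S X} {σ : Sub Γ Γ} → (∀ {B} (i : Idx Γ B) → σ i ≡ var i) → (H : Hdl Γ S X) → subH σ H ≡ H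
  subH-var h []      = refl
  subH-var h (M ∷ H) = cong₂ _∷_ (subC-var (liftS-var (liftS-var h)) M) (subH-var h H)

liftR-as-liftS : ∀ {Γ Δ B} {ρ : Ren Γ Δ} {σ : Sub Γ Δ} → (∀ {A} (i : Idx Γ A) → var (ρ i) ≡ σ i)
  → ∀ {A} (i : Idx (B ∷ Γ) A) → var (liftR ρ i) ≡ liftS σ i
liftR-as-liftS h here      = refl
liftR-as-liftS h (there i) = cong wk (h i)

mutual
  renV-as-subV : ∀ {Γ Δ A} {ρ : Ren Γ Δ} {σ : Sub Γ Δ} → (∀ {B} (i : Idx Γ B) → var (ρ i) ≡ σ i)
    → (V : Val Γ A) → renV ρ V ≡ subV σ V
  renV-as-subV h (var i)    = h i
  renV-as-subV h (lam M)    = cong lam (renC-as-subC (liftR-as-liftS h) M)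
  renV-as-subV h (tup Vs)   = cong tup (renVs-as-subVs h Vs)
  renV-as-subV h (proj i V) = cong (proj i) (renV-as-subV h V)

  renVs-as-subVs : ∀ {Γ Δ As} {ρ : Ren Γ Δ} {σ : Sub Γ Δ} → (∀ {B} (i : Idx Γ B) → var (ρ i) ≡ σ i)
    → (Vs : Vals Γ As) → renVs ρ Vs ≡ subVs σ Vs
  renVs-as-subVs h []       = refl
  renVs-as-subVs h (V ∷ Vs) = cong₂ _∷_ (renV-as-subV h V) (renVs-as-subVs h Vs)

  renC-as-subC : ∀ {Γ Δ C} {ρ : Ren Γ Δ} {σ : Sub Γ Δ} → (∀ {B} (i : Idx Γ B) → var (ρ i) ≡ σ i)
    → (M : Comp Γ C) → renC ρ M ≡ subC σ M
  renC-as-subC h (app V W)      = cong₂ app (renV-as-subV h V) (renV-as-subV h W)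
  renC-as-subC h (ret V)        = cong ret (renV-as-subV h V)
  renC-as-subC h (letin M N)    = cong₂ letin (renC-as-subC h M) (renC-as-subC (liftR-as-liftS h) N)
  renC-as-subC h (op i V)       = cong (op i) (renV-as-subV h V)
  renC-as-subC h (handle M H N) = cong₃ handle (renC-as-subC h M) (renH-as-subH h H) (renC-as-subC (liftR-as-liftS h) N)

  renH-as-subH : ∀ {Γ Δ S X} {ρ : Ren Γ Δ} {σ : Sub Γ Δ} → (∀ {B} (i : Idx Γ B) → var (ρ i) ≡ σ i)
    → (H : Hdl Γ S X) → renH ρ H ≡ subH σ H
  renH-as-subH h []      = refl
  renH-as-subH h (M ∷ H) = cong₂ _∷_ (renC-as-subC (liftR-as-liftS (liftR-as-liftS h)) M) (renH-as-subH h H)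

subV-wk-cancel : ∀ {Γ A B} {σ : Sub (B ∷ Γ) Γ} → (∀ {C} (j : Idx Γ C) → σ (there j) ≡ var j)
  → (U : Val Γ A) → subV σ (wk U) ≡ U
subV-wk-cancel h U = trans (subV-renV h U) (subV-var (λ _ → refl) U)

subV-wk-wk-cancel : ∀ {Γ A B B'} {σ : Sub (B' ∷ B ∷ Γ) Γ} → (∀ {C} (j : Idx Γ C) → σ (there (there j)) ≡ var j)
  → (U : Val Γ A) → subV σ (wk (wk U)) ≡ U
subV-wk-wk-cancel h U = trans (subV-renV (λ _ → refl) (wk U)) (subV-wk-cancel h U)

subC-wk-cancel : ∀ {Γ C B} {σ : Sub (B ∷ Γ) Γ} → (∀ {D} (j : Idx Γ D) → σ (there j) ≡ var j)
  → (M : Comp Γ C) → subC σ (renC wkR M) ≡ M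
subC-wk-cancel h M = trans (subC-renC h M) (subC-var (λ _ → refl) M)

renH-wkR-subH : ∀ {Γ Δ S X B} (σ : Sub Γ Δ) (H : Hdl Γ S X)
  → renH (wkR {B = B}) (subH σ H) ≡ subH (liftS σ) (renH wkR H)
renH-wkR-subH σ H = trans (renH-subH (λ _ → refl) H) (sym (subH-renH (λ _ → refl) H))

renC-liftR-wkR-subC : ∀ {Γ Δ A B C} (σ : Sub Γ Δ) (P : Comp (A ∷ Γ) C)
  → renC (liftR (wkR {B = B})) (subC (liftS σ) P) ≡ subC (liftS (liftS σ)) (renC (liftR wkR) P)
renC-liftR-wkR-subC σ P = trans (renC-subC commute P) (sym (subC-renC (λ _ → refl) P))
  where
  commute : ∀ {D} (j : Idx (_ ∷ _) D) → renV (liftR wkR) (liftS σ j) ≡ liftS (liftS σ) (liftR wkR j)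
  commute here      = refl
  commute (there j) = renV-liftR-wk wkR (σ j)

subC-[]c : ∀ {Γ Δ A C} (σ : Sub Γ Δ) (M : Comp (A ∷ Γ) C) (V : Val Γ A)
  → subC σ (M [ V ]c) ≡ subC (liftS σ) M [ subV σ V ]c
subC-[]c σ M V = trans (subC-subC (λ _ → refl) M) (sym (subC-subC commute M))
  where
  commute : ∀ {D} (j : Idx (_ ∷ _) D) → subV (sub1 (subV σ V)) (liftS σ j) ≡ subV σ (sub1 V j)
  commute here      = refl
  commute (there j) = subV-wk-cancel (λ _ → refl) (σ j)

subC-sub2 : ∀ {Γ Δ A K C} (σ : Sub Γ Δ) (M : Comp (K ∷ A ∷ Γ) C) (V : Val Γ A) (W : Val Γ K)
  → subC σ (subC (sub2 V W) M) ≡ subC (sub2 (subV σ V) (subV σ W)) (subC (liftS (liftS σ)) M)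
subC-sub2 σ M V W = trans (subC-subC (λ _ → refl) M) (sym (subC-subC commute M))
  where
  commute : ∀ {D} (j : Idx (_ ∷ _ ∷ _) D) → subV (sub2 (subV σ V) (subV σ W)) (liftS (liftS σ) j) ≡ subV σ (sub2 V W j)
  commute here              = refl
  commute (there here)      = refl
  commute (there (there j)) = subV-wk-wk-cancel (λ _ → refl) (σ j)

lookupH-subH : ∀ {Γ Δ S X A B} (σ : Sub Γ Δ) (H : Hdl Γ S X) (i : Idx S (A , B))
  → lookupH (subH σ H) i ≡ subC (liftS (liftS σ)) (lookupH H i)
lookupH-subH σ (M ∷ H) here      = refl
lookupH-subH σ (M ∷ H) (there i) = lookupH-subH σ H i

lookupVs-subVs : ∀ {Γ Δ As A} (σ : Sub Γ Δ) (Vs : Vals Γ As) (i : Idx As A)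
  → lookupVs (subVs σ Vs) i ≡ subV σ (lookupVs Vs i)
lookupVs-subVs σ (V ∷ Vs) here      = refl
lookupVs-subVs σ (V ∷ Vs) (there i) = lookupVs-subVs σ Vs i

subVs-tabulateVs : ∀ {Γ Δ As} (σ : Sub Γ Δ) (f : ∀ {A} → Idx As A → Val Γ A)
  → subVs σ (tabulateVs f) ≡ tabulateVs (λ i → subV σ (f i))
subVs-tabulateVs {As = []}     σ f = refl
subVs-tabulateVs {As = A ∷ As} σ f = cong (subV σ (f here) ∷_) (subVs-tabulateVs σ (λ i → f (there i)))

tabulateVs-cong : ∀ {Γ As} {fs gs : ∀ {A} → Idx As A → Val Γ A}
  → (∀ {A} (i : Idx As A) → fs i ≈v gs i) → tabulateVs fs ≈vs tabulateVs gs
tabulateVs-cong {As = []}    h = []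
tabulateVs-cong {As = _ ∷ _} h = h here ∷ tabulateVs-cong (λ i → h (there i))

lookupVs-tabulateVs : ∀ {Γ As A} (fs : ∀ {B} → Idx As B → Val Γ B) (i : Idx As A) → lookupVs (tabulateVs fs) i ≡ fs i
lookupVs-tabulateVs fs here      = refl
lookupVs-tabulateVs fs (there i) = lookupVs-tabulateVs (λ j → fs (there j)) i

≡⇒≈v : ∀ {Γ A} {V W : Val Γ A} → V ≡ W → V ≈v W
≡⇒≈v refl = reflv

≡⇒≈c : ∀ {Γ C} {M N : Comp Γ C} → M ≡ N → M ≈c N
≡⇒≈c refl = reflc

reflh : ∀ {Γ S X} {H : Hdl Γ S X} → H ≈h H
reflh {H = []}    = []
reflh {H = M ∷ H} = reflc ∷ reflh

mutual
  subV-congʳ : ∀ {Γ Δ A} (σ : Sub Γ Δ) {V W : Val Γ A} → V ≈v W → subV σ V ≈v subV σ W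
  subV-congʳ σ reflv        = reflv
  subV-congʳ σ (symv p)     = symv (subV-congʳ σ p)
  subV-congʳ σ (transv p q) = transv (subV-congʳ σ p) (subV-congʳ σ q)
  subV-congʳ σ (lamc p)     = lamc (subC-congʳ (liftS σ) p)
  subV-congʳ σ (tupc p)     = tupc (subVs-congʳ σ p)
  subV-congʳ σ (projc i p)  = projc i (subV-congʳ σ p)
  subV-congʳ σ (Πβ Vs i)    = transv (Πβ (subVs σ Vs) i) (≡⇒≈v (lookupVs-subVs σ Vs i))
  subV-congʳ σ (Πη V)       = transv (Πη (subV σ V)) (≡⇒≈v (cong tup (sym (subVs-tabulateVs σ (λ i → proj i V)))))
  subV-congʳ σ (⇒η V)       = transv (⇒η (subV σ V)) (≡⇒≈v (cong (λ U → lam (app U (var here))) (sym (subV-liftS-wk σ V))))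

  subVs-congʳ : ∀ {Γ Δ As} (σ : Sub Γ Δ) {Vs Ws : Vals Γ As} → Vs ≈vs Ws → subVs σ Vs ≈vs subVs σ Ws
  subVs-congʳ σ []       = []
  subVs-congʳ σ (p ∷ ps) = subV-congʳ σ p ∷ subVs-congʳ σ ps

  subH-congʳ : ∀ {Γ Δ S X} (σ : Sub Γ Δ) {H H' : Hdl Γ S X} → H ≈h H' → subH σ H ≈h subH σ H'
  subH-congʳ σ []       = []
  subH-congʳ σ (p ∷ ps) = subC-congʳ (liftS (liftS σ)) p ∷ subH-congʳ σ ps

  subC-congʳ : ∀ {Γ Δ C} (σ : Sub Γ Δ) {M N : Comp Γ C} → M ≈c N → subC σ M ≈c subC σ N
  subC-congʳ σ reflc           = reflc
  subC-congʳ σ (symc p)        = symc (subC-congʳ σ p)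
  subC-congʳ σ (transc p q)    = transc (subC-congʳ σ p) (subC-congʳ σ q)
  subC-congʳ σ (appc p q)      = appc (subV-congʳ σ p) (subV-congʳ σ q)
  subC-congʳ σ (retc p)        = retc (subV-congʳ σ p)
  subC-congʳ σ (letc p q)      = letc (subC-congʳ σ p) (subC-congʳ (liftS σ) q)
  subC-congʳ σ (opc i p)       = opc i (subV-congʳ σ p)
  subC-congʳ σ (handlec p q r) = handlec (subC-congʳ σ p) (subH-congʳ σ q) (subC-congʳ (liftS σ) r)
  subC-congʳ σ (⇒β M V)        = transc (⇒β (subC (liftS σ) M) (subV σ V)) (≡⇒≈c (sym (subC-[]c σ M V)))
  subC-congʳ σ (letβ V N)      = transc (letβ (subV σ V) (subC (liftS σ) N)) (≡⇒≈c (sym (subC-[]c σ N V)))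
  subC-congʳ σ (letη M)        = letη (subC σ M)
  subC-congʳ σ (letassoc M N P) =
    transc (letassoc (subC σ M) (subC (liftS σ) N) (subC (liftS σ) P))
           (≡⇒≈c (cong (λ P' → letin (subC σ M) (letin (subC (liftS σ) N) P')) (renC-liftR-wkR-subC σ P)))
  subC-congʳ σ (hret V H N)    = transc (hret (subV σ V) (subH σ H) (subC (liftS σ) N)) (≡⇒≈c (sym (subC-[]c σ N V)))
  subC-congʳ σ (hlet M N' H N) =
    transc (hlet (subC σ M) (subC (liftS σ) N') (subH σ H) (subC (liftS σ) N))
           (≡⇒≈c (cong₂ (λ H' N'' → handle (subC σ M) (subH σ H) (handle (subC (liftS σ) N') H' N''))
                        (renH-wkR-subH σ H) (renC-liftR-wkR-subC σ N)))
  subC-congʳ σ (hop i V H N)   =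
    transc (hop i (subV σ V) (subH σ H) (subC (liftS σ) N))
           (≡⇒≈c (trans (cong (subC (sub2 (subV σ V) (lam (subC (liftS σ) N)))) (lookupH-subH σ H i))
                        (sym (subC-sub2 σ (lookupH H i) V (lam N)))))

renV-congʳ : ∀ {Γ Δ A} (ρ : Ren Γ Δ) {V W : Val Γ A} → V ≈v W → renV ρ V ≈v renV ρ W
renV-congʳ ρ {V} {W} p =
  transv (≡⇒≈v (renV-as-subV (λ _ → refl) V))
         (transv (subV-congʳ (λ i → var (ρ i)) p) (≡⇒≈v (sym (renV-as-subV (λ _ → refl) W))))

renC-congʳ : ∀ {Γ Δ C} (ρ : Ren Γ Δ) {M N : Comp Γ C} → M ≈c N → renC ρ M ≈c renC ρ N
renC-congʳ ρ {M} {N} p =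
  transc (≡⇒≈c (renC-as-subC (λ _ → refl) M))
         (transc (subC-congʳ (λ i → var (ρ i)) p) (≡⇒≈c (sym (renC-as-subC (λ _ → refl) N))))

liftS-congˡ : ∀ {Γ Δ B} {σ σ' : Sub Γ Δ} → (∀ {A} (i : Idx Γ A) → σ i ≈v σ' i)
  → ∀ {A} (i : Idx (B ∷ Γ) A) → liftS σ i ≈v liftS σ' i
liftS-congˡ h here      = reflv
liftS-congˡ h (there i) = renV-congʳ wkR (h i)

mutual
  subV-congˡ : ∀ {Γ Δ A} {σ σ' : Sub Γ Δ} → (∀ {B} (i : Idx Γ B) → σ i ≈v σ' i)
    → (V : Val Γ A) → subV σ V ≈v subV σ' V
  subV-congˡ h (var i)    = h i
  subV-congˡ h (lam M)    = lamc (subC-congˡ (liftS-congˡ h) M)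
  subV-congˡ h (tup Vs)   = tupc (subVs-congˡ h Vs)
  subV-congˡ h (proj i V) = projc i (subV-congˡ h V)

  subVs-congˡ : ∀ {Γ Δ As} {σ σ' : Sub Γ Δ} → (∀ {B} (i : Idx Γ B) → σ i ≈v σ' i)
    → (Vs : Vals Γ As) → subVs σ Vs ≈vs subVs σ' Vs
  subVs-congˡ h []       = []
  subVs-congˡ h (V ∷ Vs) = subV-congˡ h V ∷ subVs-congˡ h Vs

  subC-congˡ : ∀ {Γ Δ C} {σ σ' : Sub Γ Δ} → (∀ {B} (i : Idx Γ B) → σ i ≈v σ' i)
    → (M : Comp Γ C) → subC σ M ≈c subC σ' M
  subC-congˡ h (app V W)      = appc (subV-congˡ h V) (subV-congˡ h W)
  subC-congˡ h (ret V)        = retc (subV-congˡ h V)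
  subC-congˡ h (letin M N)    = letc (subC-congˡ h M) (subC-congˡ (liftS-congˡ h) N)
  subC-congˡ h (op i V)       = opc i (subV-congˡ h V)
  subC-congˡ h (handle M H N) = handlec (subC-congˡ h M) (subH-congˡ h H) (subC-congˡ (liftS-congˡ h) N)

  subH-congˡ : ∀ {Γ Δ S X} {σ σ' : Sub Γ Δ} → (∀ {B} (i : Idx Γ B) → σ i ≈v σ' i)
    → (H : Hdl Γ S X) → subH σ H ≈h subH σ' H
  subH-congˡ h []      = []
  subH-congˡ h (M ∷ H) = subC-congˡ (liftS-congˡ (liftS-congˡ h)) M ∷ subH-congˡ h H

Val-setoid : Ctx → VTy → Setoid _ _
Val-setoid Γ A = record
  { Carrier = Val Γ A ; _≈_ = _≈v_
  ; isEquivalence = record { refl = reflv ; sym = symv ; trans = transv } }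

Comp-setoid : Ctx → CTy → Setoid _ _
Comp-setoid Γ C = record
  { Carrier = Comp Γ C ; _≈_ = _≈c_
  ; isEquivalence = record { refl = reflc ; sym = symc ; trans = transc } }

module ≈v-Reasoning {Γ A} = SetoidReasoning (Val-setoid Γ A)
module ≈c-Reasoning {Γ C} = SetoidReasoning (Comp-setoid Γ C)

-- For f : Hom A B and g : Hom C A, f ∘ g is definitionally f · g; the reasoning chains
-- below start from this form.
infixl 20 _·_
_·_ : ∀ {Γ A B} → Hom A B → Val Γ A → Val Γ B
f · v = subV ⟪ v ⟫ f

subV-· : ∀ {Γ Δ A B} (σ : Sub Γ Δ) (f : Hom A B) (v : Val Γ A) → subV σ (f · v) ≡ f · subV σ v
subV-· σ f v = subV-subV (λ { here → refl ; (there ()) }) f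

renV-· : ∀ {Γ Δ A B} (ρ : Ren Γ Δ) (f : Hom A B) (v : Val Γ A) → renV ρ (f · v) ≡ f · renV ρ v
renV-· ρ f v = renV-subV (λ { here → refl ; (there ()) }) f

∘-· : ∀ {Γ A B C} (g : Hom B C) (f : Hom A B) (v : Val Γ A) → (g ∘ f) · v ≡ g · (f · v)
∘-· g f v = subV-subV (λ { here → refl ; (there ()) }) g

·-var : ∀ {A B} (f : Hom A B) → f · var here ≡ f
·-var f = subV-var (λ { here → refl ; (there ()) }) f

·-congʳ : ∀ {Γ A B} (f : Hom A B) {v w : Val Γ A} → v ≈v w → f · v ≈v f · w
·-congʳ f p = subV-congˡ (λ { here → p ; (there ()) }) f

·-congˡ : ∀ {Γ A B} {f g : Hom A B} (v : Val Γ A) → f ≈v g → f · v ≈v g · v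
·-congˡ v p = subV-congʳ ⟪ v ⟫ p

∘-cong : ∀ {A B C} {f f' : Hom A B} {g g' : Hom B C} → f ≈ f' → g ≈ g' → g ∘ f ≈ g' ∘ f'
∘-cong {f' = f'} {g} p q = transv (·-congʳ g p) (·-congˡ f' q)

v0 : ∀ {Γ A} → Val (A ∷ Γ) A
v0 = var here

v1 : ∀ {Γ A B} → Val (B ∷ A ∷ Γ) A
v1 = var (there here)

force : ∀ {Γ C} → Val Γ (𝟙 ⇒ C) → Comp Γ C
force m = app m (tup [])

-- ηᴴ S · v and opᴴ i · v are definitionally thunk (ret v) and thunk (op i v).
thunk : ∀ {Γ C} → Comp Γ C → Val Γ (𝟙 ⇒ C)
thunk M = lam (renC wkR M)

force-thunk : ∀ {Γ C} (M : Comp Γ C) → force (thunk M) ≈c M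
force-thunk M = transc (⇒β (renC wkR M) (tup [])) (≡⇒≈c (subC-wk-cancel (λ _ → refl) M))

thunk-force : ∀ {Γ C} (m : Val Γ (𝟙 ⇒ C)) → thunk (force m) ≈v m
thunk-force m = symv (transv (⇒η m) (lamc (appc reflv (Πη v0))))

thunk-cong : ∀ {Γ C} {M N : Comp Γ C} → M ≈c N → thunk M ≈v thunk N
thunk-cong p = lamc (renC-congʳ wkR p)

subV-thunk : ∀ {Γ Δ C} (σ : Sub Γ Δ) (M : Comp Γ C) → subV σ (thunk M) ≡ thunk (subC σ M)
subV-thunk σ M = cong lam (trans (subC-renC (λ _ → refl) M) (sym (renC-subC (λ _ → refl) M)))

pair : ∀ {Γ A B} → Val Γ A → Val Γ B → Val Γ (A ⊗ B)
pair a b = tup (a ∷ b ∷ [])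

fst : ∀ {Γ A B} → Val Γ (A ⊗ B) → Val Γ A
fst = proj here

snd : ∀ {Γ A B} → Val Γ (A ⊗ B) → Val Γ B
snd = proj (there here)

fst-pair : ∀ {Γ A B} (a : Val Γ A) (b : Val Γ B) → fst (pair a b) ≈v a
fst-pair a b = Πβ (a ∷ b ∷ []) here

snd-pair : ∀ {Γ A B} (a : Val Γ A) (b : Val Γ B) → snd (pair a b) ≈v b
snd-pair a b = Πβ (a ∷ b ∷ []) (there here)

pair-η : ∀ {Γ A B} (v : Val Γ (A ⊗ B)) → pair (fst v) (snd v) ≈v v
pair-η v = symv (Πη v)

pair-cong : ∀ {Γ A B} {a a' : Val Γ A} {b b' : Val Γ B} → a ≈v a' → b ≈v b' → pair a b ≈v pair a' b'
pair-cong p q = tupc (p ∷ q ∷ [])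

bind : ∀ {Γ S C A B} → Hom (C ⊗ A) (T S B) → Val Γ C → Val Γ (T S A) → Comp Γ (B ! S)
bind f c m = letin (force m) (force (f · pair (wk c) v0))

bind-cong : ∀ {Γ S C A B} (f : Hom (C ⊗ A) (T S B)) {c c' : Val Γ C} {m m' : Val Γ (T S A)}
  → c ≈v c' → m ≈v m' → bind f c m ≈c bind f c' m'
bind-cong f p q = letc (appc q reflv) (appc (·-congʳ f (pair-cong (renV-congʳ wkR p) reflv)) reflv)

subC-bind : ∀ {Γ Δ S C A B} (σ : Sub Γ Δ) (f : Hom (C ⊗ A) (T S B)) (c : Val Γ C) (m : Val Γ (T S A))
  → subC σ (bind f c m) ≡ bind f (subV σ c) (subV σ m)
subC-bind σ f c m = cong (λ u → letin (force (subV σ m)) (force u))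
  (trans (subV-· (liftS σ) f (pair (wk c) v0)) (cong (λ c' → f · pair c' v0) (subV-liftS-wk σ c)))

extᴴ-thunk : ∀ {S C A B} (f : Hom (C ⊗ A) (T S B)) → extᴴ f ≡ thunk (bind f π₁ᴴ π₂ᴴ)
extᴴ-thunk f = cong (λ u → lam (letin (force (proj (there here) (var (there here)))) (force u)))
  (sym (renV-· (liftR wkR) f (pair (wk π₁ᴴ) v0)))

extᴴ-· : ∀ {Γ S C A B} (f : Hom (C ⊗ A) (T S B)) (w : Val Γ (C ⊗ T S A))
  → extᴴ f · w ≡ thunk (bind f (fst w) (snd w))
extᴴ-· f w = trans (cong (_· w) (extᴴ-thunk f))
  (trans (subV-thunk ⟪ w ⟫ (bind f π₁ᴴ π₂ᴴ)) (cong thunk (subC-bind ⟪ w ⟫ f π₁ᴴ π₂ᴴ)))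

extᴴ-·-pair : ∀ {Γ S C A B} (f : Hom (C ⊗ A) (T S B)) (c : Val Γ C) (m : Val Γ (T S A))
  → extᴴ f · pair c m ≈v thunk (bind f c m)
extᴴ-·-pair f c m =
  transv (≡⇒≈v (extᴴ-· f (pair c m))) (thunk-cong (bind-cong f (fst-pair c m) (snd-pair c m)))

·-pair-wk-[] : ∀ {Γ C A X} (f : Hom (C ⊗ A) X) (c : Val Γ C) (a : Val Γ A)
  → subV (sub1 a) (f · pair (wk c) v0) ≡ f · pair c a
·-pair-wk-[] f c a = trans (subV-· (sub1 a) f (pair (wk c) v0))
                           (cong (λ c' → f · pair c' a) (subV-wk-cancel (λ _ → refl) c))

·-pair-π : ∀ {C A X} (f : Hom (C ⊗ A) X) → f · pair π₁ᴴ π₂ᴴ ≈v f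
·-pair-π f = transv (·-congʳ f (pair-η v0)) (≡⇒≈v (·-var f))

bind-return : ∀ {Γ S C A B} (f : Hom (C ⊗ A) (T S B)) (c : Val Γ C) (a : Val Γ A)
  → bind f c (thunk (ret a)) ≈c force (f · pair c a)
bind-return f c a = begin
  letin (force (thunk (ret a))) (force (f · pair (wk c) v0))  ≈⟨ letc (force-thunk (ret a)) reflc ⟩
  letin (ret a) (force (f · pair (wk c) v0))                  ≈⟨ letβ a _ ⟩
  force (subV (sub1 a) (f · pair (wk c) v0))                  ≡⟨ cong force (·-pair-wk-[] f c a) ⟩
  force (f · pair c a)                                        ∎
  where open ≈c-Reasoning

bind-ηᴴ∘π₂ᴴ : ∀ {Γ S C A} (c : Val Γ C) (m : Val Γ (T S A)) → bind (ηᴴ S ∘ π₂ᴴ) c m ≈c force m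
bind-ηᴴ∘π₂ᴴ c m = begin
  letin (force m) (force (thunk (ret (snd (pair (wk c) v0)))))  ≈⟨ letc reflc (force-thunk _) ⟩
  letin (force m) (ret (snd (pair (wk c) v0)))                  ≈⟨ letc reflc (retc (snd-pair _ _)) ⟩
  letin (force m) (ret v0)                                      ≈⟨ letη _ ⟩
  force m                                                       ∎
  where open ≈c-Reasoning

bind-bind : ∀ {Γ S C A B D} (f : Hom (C ⊗ A) (T S B)) (g : Hom (C ⊗ B) (T S D))
  (c : Val Γ C) (m : Val Γ (T S A))
  → bind g c (thunk (bind f c m)) ≈c bind (extᴴ g ∘ ⟨ π₁ᴴ , f ⟩ᴴ) c m
bind-bind f g c m = begin
  letin (force (thunk (bind f c m))) (force (g · pair (wk c) v0))
    ≈⟨ letc (force-thunk _) reflc ⟩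
  letin (letin (force m) (force (f · u))) (force (g · pair (wk c) v0))
    ≈⟨ letassoc _ _ _ ⟩
  letin (force m) (letin (force (f · u)) (force (renV (liftR wkR) (g · pair (wk c) v0))))
    ≈⟨ letc reflc (symc continuation) ⟩
  letin (force m) (force ((extᴴ g ∘ ⟨ π₁ᴴ , f ⟩ᴴ) · u))
    ∎
  where
  open ≈c-Reasoning
  u = pair (wk c) v0
  continuation : force ((extᴴ g ∘ ⟨ π₁ᴴ , f ⟩ᴴ) · u)
                 ≈c letin (force (f · u)) (force (renV (liftR wkR) (g · pair (wk c) v0)))
  continuation = begin
    force ((extᴴ g ∘ ⟨ π₁ᴴ , f ⟩ᴴ) · u)        ≡⟨ cong force (∘-· (extᴴ g) ⟨ π₁ᴴ , f ⟩ᴴ u) ⟩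
    force (extᴴ g · pair (fst u) (f · u))      ≈⟨ appc (extᴴ-·-pair g _ _) reflv ⟩
    force (thunk (bind g (fst u) (f · u)))     ≈⟨ force-thunk _ ⟩
    bind g (fst u) (f · u)                     ≈⟨ bind-cong g (fst-pair _ _) reflv ⟩
    bind g (wk c) (f · u)                      ≡⟨ cong (λ c' → letin (force (f · u)) (force (g · pair c' v0)))
                                                       (sym (renV-liftR-wk wkR c)) ⟩
    letin (force (f · u)) (force (g · pair (renV (liftR wkR) (wk c)) v0))
                                               ≡⟨ cong (λ w → letin (force (f · u)) (force w))
                                                       (sym (renV-· (liftR wkR) g (pair (wk c) v0))) ⟩
    letin (force (f · u)) (force (renV (liftR wkR) (g · pair (wk c) v0)))  ∎

bind-precomp : ∀ {Γ S C C' A B} (h : Hom C' C) (f : Hom (C ⊗ A) (T S B))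
  (c : Val Γ C') (m : Val Γ (T S A))
  → bind f (h · c) m ≈c bind (f ∘ (h ×ᴴ idᴴ)) c m
bind-precomp h f c m = letc reflc (appc (symv argument) reflv)
  where
  open ≈v-Reasoning
  u = pair (wk c) v0
  argument : (f ∘ (h ×ᴴ idᴴ)) · u ≈v f · pair (wk (h · c)) v0
  argument = begin
    (f ∘ (h ×ᴴ idᴴ)) · u               ≡⟨ ∘-· f (h ×ᴴ idᴴ) u ⟩
    f · pair ((h ∘ π₁ᴴ) · u) (snd u)   ≈⟨ ·-congʳ f (pair-cong reflv (snd-pair _ _)) ⟩
    f · pair ((h ∘ π₁ᴴ) · u) v0        ≡⟨ cong (λ c' → f · pair c' v0) (∘-· h π₁ᴴ u) ⟩
    f · pair (h · fst u) v0            ≈⟨ ·-congʳ f (pair-cong (·-congʳ h (fst-pair _ _)) reflv) ⟩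
    f · pair (h · wk c) v0             ≡⟨ cong (λ c' → f · pair c' v0) (sym (renV-· wkR h c)) ⟩
    f · pair (wk (h · c)) v0           ∎

extᴴ-cong : ∀ {S C A B} {f g : Hom (C ⊗ A) (T S B)} → f ≈ g → extᴴ f ≈ extᴴ g
extᴴ-cong p = lamc (letc reflc (appc (subV-congʳ _ p) reflv))

extᴴ-unitˡ : ∀ {S C A B} (f : Hom (C ⊗ A) (T S B)) → extᴴ f ∘ (idᴴ ×ᴴ ηᴴ S) ≈ f
extᴴ-unitˡ f = begin
  extᴴ f · pair π₁ᴴ (thunk (ret π₂ᴴ))    ≈⟨ extᴴ-·-pair f _ _ ⟩
  thunk (bind f π₁ᴴ (thunk (ret π₂ᴴ)))   ≈⟨ thunk-cong (bind-return f π₁ᴴ π₂ᴴ) ⟩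
  thunk (force (f · pair π₁ᴴ π₂ᴴ))       ≈⟨ thunk-force _ ⟩
  f · pair π₁ᴴ π₂ᴴ                       ≈⟨ ·-pair-π f ⟩
  f                                      ∎
  where open ≈v-Reasoning

extᴴ-unitʳ : ∀ {S C A} → extᴴ (ηᴴ S ∘ π₂ᴴ {C} {A}) ≈ π₂ᴴ
extᴴ-unitʳ {S} = begin
  extᴴ (ηᴴ S ∘ π₂ᴴ)                   ≡⟨ extᴴ-thunk (ηᴴ S ∘ π₂ᴴ) ⟩
  thunk (bind (ηᴴ S ∘ π₂ᴴ) π₁ᴴ π₂ᴴ)   ≈⟨ thunk-cong (bind-ηᴴ∘π₂ᴴ π₁ᴴ π₂ᴴ) ⟩
  thunk (force π₂ᴴ)                   ≈⟨ thunk-force π₂ᴴ ⟩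
  π₂ᴴ                                 ∎
  where open ≈v-Reasoning

extᴴ-assoc : ∀ {S C A B D} (f : Hom (C ⊗ A) (T S B)) (g : Hom (C ⊗ B) (T S D))
  → extᴴ g ∘ ⟨ π₁ᴴ , extᴴ f ⟩ᴴ ≈ extᴴ (extᴴ g ∘ ⟨ π₁ᴴ , f ⟩ᴴ)
extᴴ-assoc f g = begin
  extᴴ g · pair π₁ᴴ (extᴴ f)                    ≈⟨ extᴴ-·-pair g _ _ ⟩
  thunk (bind g π₁ᴴ (extᴴ f))                   ≡⟨ cong (λ m → thunk (bind g π₁ᴴ m)) (extᴴ-thunk f) ⟩
  thunk (bind g π₁ᴴ (thunk (bind f π₁ᴴ π₂ᴴ)))   ≈⟨ thunk-cong (bind-bind f g π₁ᴴ π₂ᴴ) ⟩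
  thunk (bind (extᴴ g ∘ ⟨ π₁ᴴ , f ⟩ᴴ) π₁ᴴ π₂ᴴ)  ≡⟨ extᴴ-thunk (extᴴ g ∘ ⟨ π₁ᴴ , f ⟩ᴴ) ⟨
  extᴴ (extᴴ g ∘ ⟨ π₁ᴴ , f ⟩ᴴ)                  ∎
  where open ≈v-Reasoning

extᴴ-natural : ∀ {S C C' A B} (h : Hom C' C) (f : Hom (C ⊗ A) (T S B))
  → extᴴ f ∘ (h ×ᴴ idᴴ) ≈ extᴴ (f ∘ (h ×ᴴ idᴴ))
extᴴ-natural h f = begin
  extᴴ f · pair (h · π₁ᴴ) π₂ᴴ             ≈⟨ extᴴ-·-pair f _ _ ⟩
  thunk (bind f (h · π₁ᴴ) π₂ᴴ)            ≈⟨ thunk-cong (bind-precomp h f π₁ᴴ π₂ᴴ) ⟩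
  thunk (bind (f ∘ (h ×ᴴ idᴴ)) π₁ᴴ π₂ᴴ)   ≡⟨ extᴴ-thunk (f ∘ (h ×ᴴ idᴴ)) ⟨
  extᴴ (f ∘ (h ×ᴴ idᴴ))                   ∎
  where open ≈v-Reasoning

extᴴ-⟨!,id⟩-· : ∀ {Γ S A B} (f : Hom (𝟙 ⊗ A) (T S B)) (m : Val Γ (T S A))
  → (extᴴ f ∘ ⟨ !ᴴ , idᴴ ⟩ᴴ) · m ≈v thunk (bind f (tup []) m)
extᴴ-⟨!,id⟩-· f m = transv (≡⇒≈v (∘-· (extᴴ f) ⟨ !ᴴ , idᴴ ⟩ᴴ m)) (extᴴ-·-pair f (tup []) m)

μᴴ-· : ∀ {Γ S A} (m : Val Γ (T S (T S A))) → μᴴ S · m ≈v thunk (letin (force m) (force v0))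
μᴴ-· m = transv (extᴴ-⟨!,id⟩-· π₂ᴴ m) (thunk-cong (letc reflc (appc (snd-pair _ _) reflv)))

Tᴴ-· : ∀ {Γ S A B} (g : Hom A B) (m : Val Γ (T S A)) → Tᴴ S g · m ≈v thunk (letin (force m) (ret (g · v0)))
Tᴴ-· {S = S} g m = transv (extᴴ-⟨!,id⟩-· (ηᴴ S ∘ (g ∘ π₂ᴴ)) m) (thunk-cong (letc reflc continuation))
  where
  open ≈c-Reasoning
  u = pair (wk (tup [])) v0
  continuation : force ((ηᴴ S ∘ (g ∘ π₂ᴴ)) · u) ≈c ret (g · v0)
  continuation = begin
    force ((ηᴴ S ∘ (g ∘ π₂ᴴ)) · u)
      ≡⟨ cong force (trans (∘-· (ηᴴ S) (g ∘ π₂ᴴ) u) (cong (ηᴴ S ·_) (∘-· g π₂ᴴ u))) ⟩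
    force (thunk (ret (g · snd u)))  ≈⟨ force-thunk _ ⟩
    ret (g · snd u)                  ≈⟨ retc (·-congʳ g (snd-pair _ _)) ⟩
    ret (g · v0)                     ∎

Tᴴ-·-letin-return : ∀ {Γ S A B C} (g : Hom A B) (M : Comp Γ (C ! S)) (t : Val (C ∷ Γ) A)
  → Tᴴ S g · thunk (letin M (ret t)) ≈v thunk (letin M (ret (g · t)))
Tᴴ-·-letin-return g M t = transv (Tᴴ-· g _) (thunk-cong (begin
  letin (force (thunk (letin M (ret t)))) (ret (g · v0))                   ≈⟨ letc (force-thunk _) reflc ⟩
  letin (letin M (ret t)) (ret (g · v0))                                   ≈⟨ letassoc M (ret t) (ret (g · v0)) ⟩
  letin M (letin (ret t) (ret (renV (liftR wkR) (g · v0))))                ≈⟨ letc reflc (letβ t _) ⟩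
  letin M (ret (subV (sub1 t) (renV (liftR wkR) (g · v0))))
    ≡⟨ cong (λ u → letin M (ret u))
            (trans (cong (subV (sub1 t)) (renV-· (liftR wkR) g v0)) (subV-· (sub1 t) g v0)) ⟩
  letin M (ret (g · t))                                                    ∎))
  where open ≈c-Reasoning

bind-ηᴴ : ∀ {Γ S C A} (c : Val Γ C) (m : Val Γ (T S A))
  → bind (ηᴴ S) c m ≈c letin (force m) (ret (pair (wk c) v0))
bind-ηᴴ c m = letc reflc (force-thunk _)

curryᴴ : ∀ {S A B C} → Hom (C ⊗ A) (T S B) → Hom C (A ⇒ (B ! S))
curryᴴ f = lam (force (f · pair v1 v0))

curryᴴ-β : ∀ {Γ S A B C} (f : Hom (C ⊗ A) (T S B)) (c : Val Γ C) (a : Val Γ A)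
  → app (curryᴴ f · c) a ≈c force (f · pair c a)
curryᴴ-β f c a = transc (⇒β _ a) (≡⇒≈c (cong force (trans
  (cong (subV (sub1 a)) (subV-· (liftS ⟪ c ⟫) f (pair v1 v0))) (·-pair-wk-[] f c a))))

evᴴ-·-pair : ∀ {Γ S A B} (g : Val Γ (A ⇒ (B ! S))) (a : Val Γ A) → evᴴ · pair g a ≈v thunk (app g a)
evᴴ-·-pair g a = lamc (appc (fst-pair _ _) (snd-pair _ _))

evᴴ-×-·-pair : ∀ {Γ S A B C} (g : Hom C (A ⇒ (B ! S))) (c : Val Γ C) (a : Val Γ A)
  → (evᴴ ∘ (g ×ᴴ idᴴ)) · pair c a ≈v thunk (app (g · c) a)
evᴴ-×-·-pair g c a = begin
  (evᴴ ∘ (g ×ᴴ idᴴ)) · pair c a                       ≡⟨ ∘-· evᴴ (g ×ᴴ idᴴ) (pair c a) ⟩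
  evᴴ · pair ((g ∘ π₁ᴴ) · pair c a) (snd (pair c a))
    ≡⟨ cong (λ g' → evᴴ · pair g' (snd (pair c a))) (∘-· g π₁ᴴ (pair c a)) ⟩
  evᴴ · pair (g · fst (pair c a)) (snd (pair c a))
    ≈⟨ ·-congʳ evᴴ (pair-cong (·-congʳ g (fst-pair c a)) (snd-pair c a)) ⟩
  evᴴ · pair (g · c) a                                ≈⟨ evᴴ-·-pair (g · c) a ⟩
  thunk (app (g · c) a)                               ∎
  where open ≈v-Reasoning

evᴴ-curryᴴ : ∀ {S A B C} (f : Hom (C ⊗ A) (T S B)) → evᴴ ∘ (curryᴴ f ×ᴴ idᴴ) ≈ f
evᴴ-curryᴴ f = begin
  evᴴ · pair (curryᴴ f · π₁ᴴ) π₂ᴴ         ≈⟨ evᴴ-·-pair _ _ ⟩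
  thunk (app (curryᴴ f · π₁ᴴ) π₂ᴴ)        ≈⟨ thunk-cong (curryᴴ-β f π₁ᴴ π₂ᴴ) ⟩
  thunk (force (f · pair π₁ᴴ π₂ᴴ))        ≈⟨ thunk-force _ ⟩
  f · pair π₁ᴴ π₂ᴴ                        ≈⟨ ·-pair-π f ⟩
  f                                       ∎
  where open ≈v-Reasoning

curryᴴ-unique : ∀ {S A B C} (f : Hom (C ⊗ A) (T S B)) (g : Hom C (A ⇒ (B ! S)))
  → evᴴ ∘ (g ×ᴴ idᴴ) ≈ f → g ≈ curryᴴ f
curryᴴ-unique f g p = begin
  g                                                  ≈⟨ ⇒η g ⟩
  lam (app (wk g) v0)                                ≡⟨ cong (λ g' → lam (app g' v0)) wk-g ⟩
  lam (app (g · v1) v0)                              ≈⟨ lamc (symc (force-thunk _)) ⟩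
  lam (force (thunk (app (g · v1) v0)))              ≈⟨ lamc (appc (symv (evᴴ-×-·-pair g v1 v0)) reflv) ⟩
  lam (force ((evᴴ ∘ (g ×ᴴ idᴴ)) · pair v1 v0))      ≈⟨ lamc (appc (·-congˡ (pair v1 v0) p) reflv) ⟩
  lam (force (f · pair v1 v0))                       ∎
  where
  open ≈v-Reasoning
  wk-g : wk g ≡ g · v1
  wk-g = trans (cong wk (sym (·-var g))) (renV-· wkR g v0)

Clauses : Ctx → Sig → CTy → Set
Clauses Γ S X = ∀ {A B} → Idx S (A , B) → Comp ((B ⇒ X) ∷ A ∷ Γ) X

buildH-≡ : ∀ {Γ S X} {F G : Clauses Γ S X}
  → (∀ {A B} (i : Idx S (A , B)) → F i ≡ G i) → buildH F ≡ buildH G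
buildH-≡ {S = []}    h = refl
buildH-≡ {S = _ ∷ S} h = cong₂ _∷_ (h here) (buildH-≡ (λ i → h (there i)))

buildH-cong : ∀ {Γ S X} {F G : Clauses Γ S X}
  → (∀ {A B} (i : Idx S (A , B)) → F i ≈c G i) → buildH F ≈h buildH G
buildH-cong {S = []}    h = []
buildH-cong {S = _ ∷ S} h = h here ∷ buildH-cong (λ i → h (there i))

subH-buildH : ∀ {Γ Δ S X} (σ : Sub Γ Δ) (F : Clauses Γ S X)
  → subH σ (buildH F) ≡ buildH (λ i → subC (liftS (liftS σ)) (F i))
subH-buildH {S = []}    σ F = refl
subH-buildH {S = _ ∷ S} σ F = cong (subC (liftS (liftS σ)) (F here) ∷_) (subH-buildH σ (λ i → F (there i)))

lookupH-buildH : ∀ {Γ S X A B} (F : Clauses Γ S X) (i : Idx S (A , B)) → lookupH (buildH F) i ≡ F i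
lookupH-buildH F here      = refl
lookupH-buildH F (there i) = lookupH-buildH (λ j → F (there j)) i

handlerOf : ∀ {Γ S X} → Val Γ (HT S X) → Hdl Γ S X
handlerOf h = buildH (λ i → app (proj (hidx i) (wk (wk h))) (pair v1 v0))

handleWith : ∀ {Γ S S' A} → Val Γ (HT S (A ! S')) → Val Γ (T S (T S' A)) → Comp Γ (A ! S')
handleWith h m = handle (force m) (handlerOf h) (force v0)

subH-handlerOf : ∀ {Γ Δ S X} (σ : Sub Γ Δ) (h : Val Γ (HT S X)) → subH σ (handlerOf h) ≡ handlerOf (subV σ h)
subH-handlerOf σ h = trans (subH-buildH σ _) (buildH-≡ (λ i → cong (λ h' → app (proj (hidx i) h') (pair v1 v0))
  (trans (subV-liftS-wk (liftS σ) (wk h)) (cong wk (subV-liftS-wk σ h)))))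

renH-handlerOf : ∀ {Γ Δ S X} (ρ : Ren Γ Δ) (h : Val Γ (HT S X)) → renH ρ (handlerOf h) ≡ handlerOf (renV ρ h)
renH-handlerOf ρ h = trans (renH-as-subH (λ _ → refl) (handlerOf h))
  (trans (subH-handlerOf (λ i → var (ρ i)) h) (cong handlerOf (sym (renV-as-subV (λ _ → refl) h))))

handlerOf-cong : ∀ {Γ S X} {h h' : Val Γ (HT S X)} → h ≈v h' → handlerOf h ≈h handlerOf h'
handlerOf-cong p = buildH-cong (λ i → appc (projc (hidx i) (renV-congʳ wkR (renV-congʳ wkR p))) reflv)

handleWith-cong : ∀ {Γ S S' A} {h h' : Val Γ (HT S (A ! S'))} {m m' : Val Γ (T S (T S' A))}
  → h ≈v h' → m ≈v m' → handleWith h m ≈c handleWith h' m'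
handleWith-cong p q = handlec (appc q reflv) (handlerOf-cong p) reflc

subC-handleWith : ∀ {Γ Δ S S' A} (σ : Sub Γ Δ) (h : Val Γ (HT S (A ! S'))) (m : Val Γ (T S (T S' A)))
  → subC σ (handleWith h m) ≡ handleWith (subV σ h) (subV σ m)
subC-handleWith σ h m = cong (λ H → handle (force (subV σ m)) H (force v0)) (subH-handlerOf σ h)

handleᴴ-thunk : ∀ S S' A → handleᴴ S S' A ≡ thunk (handleWith π₁ᴴ π₂ᴴ)
handleᴴ-thunk S S' A =
  cong (λ H → lam (handle (force (proj (there here) (var (there here)))) H (force (var here))))
       (sym (renH-handlerOf wkR π₁ᴴ))

handleᴴ-·-pair : ∀ {Γ S S' A} (h : Val Γ (HT S (A ! S'))) (m : Val Γ (T S (T S' A)))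
  → handleᴴ S S' A · pair h m ≈v thunk (handleWith h m)
handleᴴ-·-pair {S = S} {S'} {A} h m = begin
  handleᴴ S S' A · pair h m                            ≡⟨ cong (_· pair h m) (handleᴴ-thunk S S' A) ⟩
  thunk (handleWith π₁ᴴ π₂ᴴ) · pair h m                ≡⟨ subV-thunk ⟪ pair h m ⟫ (handleWith π₁ᴴ π₂ᴴ) ⟩
  thunk (subC ⟪ pair h m ⟫ (handleWith π₁ᴴ π₂ᴴ))       ≡⟨ cong thunk (subC-handleWith ⟪ pair h m ⟫ π₁ᴴ π₂ᴴ) ⟩
  thunk (handleWith (fst (pair h m)) (snd (pair h m)))
    ≈⟨ thunk-cong (handleWith-cong (fst-pair h m) (snd-pair h m)) ⟩
  thunk (handleWith h m)                               ∎
  where open ≈v-Reasoning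

handleWith-return : ∀ {Γ S S' A} (h : Val Γ (HT S (A ! S'))) (t : Val Γ (T S' A))
  → handleWith h (thunk (ret t)) ≈c force t
handleWith-return h t = transc (handlec (force-thunk _) reflh reflc) (hret t _ _)

handleWith-letin : ∀ {Γ S S' A B} (h : Val Γ (HT S (A ! S'))) (M : Comp Γ (B ! S)) (N : Comp (B ∷ Γ) (T S' A ! S))
  → handleWith h (thunk (letin M N)) ≈c handle M (handlerOf h) (handle N (handlerOf (wk h)) (force v0))
handleWith-letin h M N = begin
  handle (force (thunk (letin M N))) (handlerOf h) (force v0)  ≈⟨ handlec (force-thunk _) reflh reflc ⟩
  handle (letin M N) (handlerOf h) (force v0)                  ≈⟨ hlet M N (handlerOf h) (force v0) ⟩
  handle M (handlerOf h) (handle N (renH wkR (handlerOf h)) (force v0))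
      ≡⟨ cong (λ H → handle M (handlerOf h) (handle N H (force v0))) (renH-handlerOf wkR h) ⟩
  handle M (handlerOf h) (handle N (handlerOf (wk h)) (force v0))  ∎
  where open ≈c-Reasoning

handle-op-handlerOf : ∀ {Γ S A B X} (h : Val Γ (HT S X)) (i : Idx S (A , B)) (a : Val Γ A) (N : Comp (B ∷ Γ) X)
  → handle (op i a) (handlerOf h) N ≈c app (proj (hidx i) h) (pair a (lam N))
handle-op-handlerOf h i a N = transc (hop i a (handlerOf h) N) (≡⇒≈c (trans
  (cong (subC (sub2 a (lam N))) (lookupH-buildH _ i))
  (cong (λ h' → app (proj (hidx i) h') (pair a (lam N))) (subV-wk-wk-cancel (λ _ → refl) h))))

handleWith-letin-return : ∀ {Γ S S' A B} (h : Val Γ (HT S (A ! S'))) (M : Comp Γ (B ! S)) (t : Val (B ∷ Γ) (T S' A))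
  → handleWith h (thunk (letin M (ret t))) ≈c handle M (handlerOf h) (force t)
handleWith-letin-return h M t = transc (handleWith-letin h M (ret t)) (handlec reflc reflh (hret t _ _))

aᴴ-· : ∀ {Γ S S' X A B} (i : Idx S (A , B)) (v : Val Γ (A ⊗ (B ⇒ (X ! S'))))
  → aᴴ S' i · v ≈v thunk (letin (op i (fst v)) (ret (thunk (app (wk (snd v)) v0))))
aᴴ-· {S = S} {S'} i v = begin
  aᴴ S' i · v
    ≡⟨ trans (∘-· (Tᴴ S evᴴ) (stᴴ S ∘ (swapᴴ ∘ (opᴴ i ×ᴴ idᴴ))) v)
             (cong (Tᴴ S evᴴ ·_) (trans (∘-· (stᴴ S) (swapᴴ ∘ (opᴴ i ×ᴴ idᴴ)) v)
                                        (cong (stᴴ S ·_) (∘-· swapᴴ (opᴴ i ×ᴴ idᴴ) v)))) ⟩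
  Tᴴ S evᴴ · (stᴴ S · pair (snd (pair opᵢ (snd v))) (fst (pair opᵢ (snd v))))
    ≈⟨ ·-congʳ (Tᴴ S evᴴ) (·-congʳ (stᴴ S) (pair-cong (snd-pair _ _) (fst-pair _ _))) ⟩
  Tᴴ S evᴴ · (stᴴ S · pair (snd v) opᵢ)
    ≈⟨ ·-congʳ (Tᴴ S evᴴ) (extᴴ-·-pair (ηᴴ S) _ _) ⟩
  Tᴴ S evᴴ · thunk (bind (ηᴴ S) (snd v) opᵢ)
    ≈⟨ ·-congʳ (Tᴴ S evᴴ) (thunk-cong (transc (bind-ηᴴ _ _) (letc (force-thunk _) reflc))) ⟩
  Tᴴ S evᴴ · thunk (letin (op i (fst v)) (ret (pair (wk (snd v)) v0)))
    ≈⟨ Tᴴ-·-letin-return evᴴ _ _ ⟩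
  thunk (letin (op i (fst v)) (ret (evᴴ · pair (wk (snd v)) v0)))
    ≈⟨ thunk-cong (letc reflc (retc (evᴴ-·-pair _ _))) ⟩
  thunk (letin (op i (fst v)) (ret (thunk (app (wk (snd v)) v0))))  ∎
  where
  open ≈v-Reasoning
  opᵢ = thunk (op i (fst v))

handleᴴ-η : ∀ {S S' X} → handleᴴ S S' X ∘ (idᴴ ×ᴴ ηᴴ S) ≈ π₂ᴴ
handleᴴ-η {S} {S'} {X} = begin
  handleᴴ S S' X · pair π₁ᴴ (thunk (ret π₂ᴴ))   ≈⟨ handleᴴ-·-pair _ _ ⟩
  thunk (handleWith π₁ᴴ (thunk (ret π₂ᴴ)))      ≈⟨ thunk-cong (handleWith-return π₁ᴴ π₂ᴴ) ⟩
  thunk (force π₂ᴴ)                             ≈⟨ thunk-force π₂ᴴ ⟩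
  π₂ᴴ                                           ∎
  where open ≈v-Reasoning

-- Both sides handle the outer layer with the given handler and, in its continuation, the
-- inner layer with the same handler.
handleᴴ-μ : ∀ {S S' X}
  → handleᴴ S S' X ∘ (idᴴ ×ᴴ μᴴ S) ≈ handleᴴ S S' X ∘ ((idᴴ ×ᴴ Tᴴ S (handleᴴ S S' X)) ∘ ⟨ π₁ᴴ , stᴴ S ⟩ᴴ)
handleᴴ-μ {S} {S'} {X} = transv flatten (symv nest)
  where
  open ≈v-Reasoning
  hd = handleᴴ S S' X
  r = pair π₁ᴴ (stᴴ S)
  handled : Hom (HT S (X ! S') ⊗ T S (T S (T S' X))) (T S' X)
  handled = thunk (handle (force π₂ᴴ) (handlerOf π₁ᴴ) (handleWith (wk π₁ᴴ) v0))
  flatten : hd ∘ (idᴴ ×ᴴ μᴴ S) ≈ handled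
  flatten = begin
    hd · pair π₁ᴴ (μᴴ S · π₂ᴴ)
      ≈⟨ handleᴴ-·-pair _ _ ⟩
    thunk (handleWith π₁ᴴ (μᴴ S · π₂ᴴ))
      ≈⟨ thunk-cong (handleWith-cong reflv (μᴴ-· π₂ᴴ)) ⟩
    thunk (handleWith π₁ᴴ (thunk (letin (force π₂ᴴ) (force v0))))
      ≈⟨ thunk-cong (handleWith-letin _ _ _) ⟩
    handled
      ∎
  stᴴ-generic : stᴴ S ≈v thunk (letin (force π₂ᴴ) (ret (pair (wk π₁ᴴ) v0)))
  stᴴ-generic = transv (≡⇒≈v (extᴴ-thunk (ηᴴ S))) (thunk-cong (bind-ηᴴ π₁ᴴ π₂ᴴ))
  nest : hd ∘ ((idᴴ ×ᴴ Tᴴ S hd) ∘ r) ≈ handled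
  nest = begin
    hd · pair (fst r) ((Tᴴ S hd ∘ π₂ᴴ) · r)
      ≈⟨ handleᴴ-·-pair _ _ ⟩
    thunk (handleWith (fst r) ((Tᴴ S hd ∘ π₂ᴴ) · r))
      ≡⟨ cong (λ m → thunk (handleWith (fst r) m)) (∘-· (Tᴴ S hd) π₂ᴴ r) ⟩
    thunk (handleWith (fst r) (Tᴴ S hd · snd r))
      ≈⟨ thunk-cong (handleWith-cong (fst-pair _ _) (·-congʳ (Tᴴ S hd) (transv (snd-pair _ _) stᴴ-generic))) ⟩
    thunk (handleWith π₁ᴴ (Tᴴ S hd · thunk (letin (force π₂ᴴ) (ret (pair (wk π₁ᴴ) v0)))))
      ≈⟨ thunk-cong (handleWith-cong reflv (Tᴴ-·-letin-return hd _ _)) ⟩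
    thunk (handleWith π₁ᴴ (thunk (letin (force π₂ᴴ) (ret (hd · pair (wk π₁ᴴ) v0)))))
      ≈⟨ thunk-cong (handleWith-letin-return _ _ _) ⟩
    thunk (handle (force π₂ᴴ) (handlerOf π₁ᴴ) (force (hd · pair (wk π₁ᴴ) v0)))
      ≈⟨ thunk-cong (handlec reflc reflh (transc (appc (handleᴴ-·-pair _ _) reflv) (force-thunk _))) ⟩
    handled
      ∎

handleᴴ-op : ∀ {S S' X A B} (i : Idx S (A , B))
  → handleᴴ S S' X ∘ (idᴴ ×ᴴ aᴴ S' i) ≈ evᴴ ∘ (projᴴ (hidx i) ×ᴴ idᴴ)
handleᴴ-op {S} {S'} {X} i = begin
  handleᴴ S S' X · pair π₁ᴴ (aᴴ S' i · π₂ᴴ)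
    ≈⟨ handleᴴ-·-pair _ _ ⟩
  thunk (handleWith π₁ᴴ (aᴴ S' i · π₂ᴴ))
    ≈⟨ thunk-cong (handleWith-cong reflv (aᴴ-· i π₂ᴴ)) ⟩
  thunk (handleWith π₁ᴴ (thunk (letin (op i a) (ret (thunk kx)))))
    ≈⟨ thunk-cong (handleWith-letin-return _ _ _) ⟩
  thunk (handle (op i a) (handlerOf π₁ᴴ) (force (thunk kx)))
    ≈⟨ thunk-cong (handlec reflc reflh (force-thunk _)) ⟩
  thunk (handle (op i a) (handlerOf π₁ᴴ) kx)
    ≈⟨ thunk-cong (handle-op-handlerOf π₁ᴴ i a kx) ⟩
  thunk (app (proj (hidx i) π₁ᴴ) (pair a (lam kx)))
    ≈⟨ thunk-cong (appc reflv (pair-cong reflv (symv (⇒η k)))) ⟩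
  thunk (app (proj (hidx i) π₁ᴴ) (pair a k))
    ≈⟨ thunk-cong (appc reflv (pair-η π₂ᴴ)) ⟩
  thunk (app (proj (hidx i) π₁ᴴ) π₂ᴴ)
    ≈⟨ evᴴ-·-pair _ _ ⟨
  evᴴ · pair (proj (hidx i) π₁ᴴ) π₂ᴴ
    ∎
  where
  open ≈v-Reasoning
  a = fst π₂ᴴ
  k = snd π₂ᴴ
  kx = app (wk k) v0

theorem4p8 : TermModelAxioms
theorem4p8 = record
  { ∘-resp     = ∘-cong
  ; idˡ        = λ f → reflv
  ; idʳ        = λ f → ≡⇒≈v (·-var f)
  ; assoc      = λ f g h → ≡⇒≈v (∘-· h g f)
  ; tuple-resp = λ h → tupc (tabulateVs-cong h)
  ; tuple-β    = λ fs i → transv (Πβ (tabulateVs fs) i) (≡⇒≈v (lookupVs-tabulateVs fs i))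
  ; tuple-η    = Πη
  ; ext-resp   = extᴴ-cong
  ; kl-unitˡ   = extᴴ-unitˡ
  ; kl-unitʳ   = extᴴ-unitʳ
  ; kl-assoc   = extᴴ-assoc
  ; kl-nat     = extᴴ-natural
  ; kl-exp     = λ f → curryᴴ f , evᴴ-curryᴴ f , curryᴴ-unique f
  ; handle-η   = handleᴴ-η
  ; handle-μ   = handleᴴ-μ
  ; handle-op  = handleᴴ-op
  }
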